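{- Let $G$ be a graph, $\chi:=\chi(G)$, $\chi':=\chi'(G)$ and $\Delta:=\Delta(G)$. Writing $\chi_\ell(G):=\chi(\mathbb{L}_\ell(G))$: (1) if $\ell\geqslant0$ is even, then $\chi_\ell(G)\leqslant\min\{\chi,\lfloor(2/3)^{\ell/2}(\chi-3)\rfloor+3\}$; (2) if $\ell\geqslant1$ is odd, then $\chi_\ell(G)\leqslant\min\{\chi',\lfloor(2/3)^{(\ell-1)/2}(\chi'-3)\rfloor+3\}$; (3) if $\ell\neq1$, then $\chi_\ell(G)\leqslant\Delta+1$; (4) if $\ell\geqslant2$, then $\chi_\ell(G)\leqslant\chi_{\ell-2}(G)$.
   Context: All graphs are finite, undirected and loopless; parallel edges are allowed. For $\ell\geqslant0$, an $\ell$-arc of $G$ is a sequence $(v_0,e_1,v_1,\ldots,e_\ell,v_\ell)$ with each $e_i$ an edge with ends $v_{i-1},v_i$ and $e_i\neq e_{i+1}$ for $1\leqslant i\leqslant\ell-1$; an $\ell$-link is an $\ell$-arc identified with its reverse. The $\ell$-link graph $\mathbb{L}_\ell(G)$ has vertex set the $\ell$-links of $G$, and $\ell$-links $L,R$ are joined by as many edges as there are $(\ell+1)$-links $[v_0,e_1,\ldots,e_{\ell+1},v_{\ell+1}]$ with $\{[v_0,\ldots,v_\ell],[v_1,\ldots,v_{\ell+1}]\}=\{L,R\}$. $\chi$ is the chromatic number, $\chi'$ the edge-chromatic number (minimum number of colours in an edge colouring with edges sharing an end vertex coloured differently), $\Delta$ the maximum degree. -}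

module Defs where

open import Data.Nat using (ℕ; zero; suc; _+_; _*_; _≤_; _⊔_)
open import Data.Fin using (Fin; toℕ; inject₁) renaming (suc to fsuc)
import Data.Fin as Fin
open import Data.Fin.Properties using (_≟_)
open import Data.Product using (Σ; Σ-syntax; ∃; _×_; _,_; proj₁; proj₂)
open import Data.Sum using (_⊎_)
open import Data.List using (List; length; filter; map; foldr; allFin)
open import Data.Vec using (Vec; lookup; reverse; init; tail)
open import Data.Integer as ℤ using (ℤ; +_)
open import Data.Rational as ℚ using (ℚ; floor; 1ℚ)
open import Relation.Nullary using (¬_)
open import Relation.Nullary.Decidable using (_⊎-dec_)
open import Relation.Binary.PropositionalEquality using (_≡_; _≢_)

record Graph : Set where
  field
    n : ℕ
    m : ℕ
    ends : Fin m → Fin n × Fin n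
    loopless : ∀ e → proj₁ (ends e) ≢ proj₂ (ends e)
open Graph public

module _ (G : Graph) where

  Incident : Fin (n G) → Fin (m G) → Set
  Incident v e = (proj₁ (ends G e) ≡ v) ⊎ (proj₂ (ends G e) ≡ v)

  Joins : Fin (m G) → Fin (n G) → Fin (n G) → Set
  Joins e u v = (ends G e ≡ (u , v)) ⊎ (ends G e ≡ (v , u))

  Colourable : ℕ → Set
  Colourable k = Σ[ c ∈ (Fin (n G) → Fin k) ]
    (∀ e → c (proj₁ (ends G e)) ≢ c (proj₂ (ends G e)))

  IsChromaticNumber : ℕ → Set
  IsChromaticNumber k = Colourable k × (∀ j → Colourable j → k ≤ j)

  EdgeColourable : ℕ → Set
  EdgeColourable k = Σ[ c ∈ (Fin (m G) → Fin k) ]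
    (∀ e f → e ≢ f → (Σ[ v ∈ Fin (n G) ] (Incident v e × Incident v f)) → c e ≢ c f)

  IsEdgeChromaticNumber : ℕ → Set
  IsEdgeChromaticNumber k = EdgeColourable k × (∀ j → EdgeColourable j → k ≤ j)

  degree : Fin (n G) → ℕ
  degree v = length (filter (λ e → (proj₁ (ends G e) ≟ v) ⊎-dec (proj₂ (ends G e) ≟ v)) (allFin (m G)))

  -- maximum degree (0 for the empty graph)
  maxDegree : ℕ
  maxDegree = foldr _⊔_ 0 (map degree (allFin (n G)))

  IsArc : ∀ {ℓ} → Vec (Fin (n G)) (suc ℓ) → Vec (Fin (m G)) ℓ → Set
  IsArc {ℓ} vs es =
    (∀ (i : Fin ℓ) → Joins (lookup es i) (lookup vs (inject₁ i)) (lookup vs (fsuc i)))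
    × (∀ (i j : Fin ℓ) → toℕ j ≡ suc (toℕ i) → lookup es i ≢ lookup es j)

  -- A proper k-colouring of the ℓ-link graph L_ℓ(G): a colouring of ℓ-arcs that
  -- is invariant under reversal (i.e. a colouring of ℓ-links), such that for every
  -- (ℓ+1)-arc, its initial ℓ-link and its final ℓ-link receive different colours.
  LinkColourable : ℕ → ℕ → Set
  LinkColourable ℓ k = Σ[ c ∈ (Vec (Fin (n G)) (suc ℓ) → Vec (Fin (m G)) ℓ → Fin k) ]
    ((∀ vs es → IsArc vs es → c vs es ≡ c (reverse vs) (reverse es))
    × (∀ (vs : Vec (Fin (n G)) (suc (suc ℓ))) (es : Vec (Fin (m G)) (suc ℓ)) →
         IsArc vs es → c (init vs) (init es) ≢ c (tail vs) (tail es)))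

twoThirdsPow : ℕ → ℚ
twoThirdsPow zero = 1ℚ
twoThirdsPow (suc j) = ((+ 2) ℚ./ 3) ℚ.* twoThirdsPow j

bound : ℕ → ℕ → ℤ
bound x j = (+ x) ℤ.⊓ (floor (twoThirdsPow j ℚ.* ((+ x ℤ.- + 3) ℚ./ 1)) ℤ.+ + 3)

module Submission where

-- An (ℓ+2)-arc has three ℓ-sub-arcs;
-- any rule (a, m, b) ↦ colour that is symmetric in a, b and separates the
-- overlapping triples (a, m, b), (m, b, d) whenever m ≢ b turns a k-colouring of
-- L_ℓ(G) into one of L_{ℓ+2}(G) (LinkColourings).  Keeping m gives part (4);
-- TwoThirdsCompression gives such a rule with ⌊2k/3⌋ + 1 colours.  Starting
-- from L_0(G) = G or L_1(G) = line graph, χ_ℓ ≤ b_j where b_{j+1} = min {b_j,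
-- ⌊2b_j/3⌋ + 1}, and ShrinkBound shows b_j ≤ min {χ, ⌊(2/3)^j (χ - 3)⌋ + 3}:
-- parts (1), (2).  For part (3), even ℓ start from a greedy (Δ+1)-colouring,
-- odd ℓ ≥ 3 from L_3(G), coloured by compressing an edge colouring with
-- ⌊3Δ/2⌋ colours, which exists by Shannon's theorem (proved by Kempe chains).

open import Defs
open import Data.Nat using (ℕ; suc; _+_; _*_; _≤_; _∸_)
open import Data.Integer using (+_)
open import Data.Product using (Σ-syntax; _×_)
open import Relation.Binary.PropositionalEquality using (_≡_; _≢_)

module Incidence (G : Graph) where

  open import Data.Fin using (Fin)
  open import Data.Product using (Σ; _,_; proj₁; proj₂)
  open import Data.Sum using (_⊎_; inj₁; inj₂)
  open import Relation.Binary.PropositionalEquality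

  end₁ end₂ : Fin (m G) → Fin (n G)
  end₁ e = proj₁ (ends G e)
  end₂ e = proj₂ (ends G e)

  joins-first : ∀ {e a b} → Joins G e a b → Incident G a e
  joins-first (inj₁ q) = inj₁ (cong proj₁ q)
  joins-first (inj₂ q) = inj₂ (cong proj₂ q)

  joins-second : ∀ {e a b} → Joins G e a b → Incident G b e
  joins-second (inj₁ q) = inj₂ (cong proj₂ q)
  joins-second (inj₂ q) = inj₁ (cong proj₁ q)

  joins-incident : ∀ {e a b z} → Joins G e a b → Incident G z e → z ≡ a ⊎ z ≡ b
  joins-incident (inj₁ q) (inj₁ r) = inj₁ (trans (sym r) (cong proj₁ q))
  joins-incident (inj₁ q) (inj₂ r) = inj₂ (trans (sym r) (cong proj₂ q))
  joins-incident (inj₂ q) (inj₁ r) = inj₂ (trans (sym r) (cong proj₁ q))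
  joins-incident (inj₂ q) (inj₂ r) = inj₁ (trans (sym r) (cong proj₂ q))

  joins-distinct : ∀ {e a b} → Joins G e a b → a ≢ b
  joins-distinct {e} (inj₁ q) a=b = loopless G e (trans (cong proj₁ q) (trans a=b (sym (cong proj₂ q))))
  joins-distinct {e} (inj₂ q) a=b = loopless G e (trans (cong proj₁ q) (trans (sym a=b) (sym (cong proj₂ q))))

  otherEnd : ∀ {x e} → Incident G x e → Σ (Fin (n G)) λ w → Joins G e x w
  otherEnd {e = e} (inj₁ q) = end₂ e , inj₁ (cong (_, end₂ e) q)
  otherEnd {e = e} (inj₂ q) = end₁ e , inj₂ (cong (end₁ e ,_) q)

  incident-ends : ∀ {z e} → Incident G z e → z ≡ end₁ e ⊎ z ≡ end₂ e
  incident-ends (inj₁ q) = inj₁ (sym q)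
  incident-ends (inj₂ q) = inj₂ (sym q)

module LinkColourings where

  open import Data.Nat using (ℕ; suc; _≤_)
  open import Data.Fin using (Fin; toℕ; inject₁; inject≤) renaming (zero to fzero; suc to fsuc)
  open import Data.Fin.Properties using (toℕ-inject₁; inject≤-injective)
  open import Data.Vec using (Vec; _∷_; []; lookup; reverse; init; tail; head)
  open import Data.Vec.Properties using (init-reverse; reverse-involutive)
  open import Data.Product using (_,_; proj₁; proj₂)
  open import Data.Sum using (inj₁; inj₂)
  open import Function using (_∘_)
  open import Relation.Binary.PropositionalEquality

  lookup-init : ∀ {A : Set} {n} (v : Vec A (suc n)) (i : Fin n) → lookup (init v) i ≡ lookup v (inject₁ i)
  lookup-init (x ∷ y ∷ xs) fzero = refl
  lookup-init (x ∷ y ∷ xs) (fsuc i) = lookup-init (y ∷ xs) i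

  tail-init : ∀ {A : Set} {n} (v : Vec A (suc (suc n))) → tail (init v) ≡ init (tail v)
  tail-init (x ∷ xs) = refl

  reverse-init : ∀ {A : Set} {n} (v : Vec A (suc n)) → reverse (init v) ≡ tail (reverse v)
  reverse-init v = begin
    reverse (init v)                     ≡⟨ cong (reverse ∘ init) (sym (reverse-involutive v)) ⟩
    reverse (init (reverse (reverse v))) ≡⟨ cong reverse (init-reverse (reverse v)) ⟩
    reverse (reverse (tail (reverse v))) ≡⟨ reverse-involutive (tail (reverse v)) ⟩
    tail (reverse v)                     ∎
    where open ≡-Reasoning

  -- Applied to the
  -- vertices and edges of an (ℓ+2)-arc they give its first, middle and last ℓ-arc.

  firstSub middleSub lastSub : ∀ {A : Set} {n} → Vec A (suc (suc n)) → Vec A n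
  firstSub v = init (init v)
  middleSub v = tail (init v)
  lastSub v = tail (tail v)

  firstSub-reverse : ∀ {A : Set} {n} (v : Vec A (suc (suc n))) → firstSub (reverse v) ≡ reverse (lastSub v)
  firstSub-reverse v = trans (cong init (init-reverse v)) (init-reverse (tail v))

  middleSub-reverse : ∀ {A : Set} {n} (v : Vec A (suc (suc n))) → middleSub (reverse v) ≡ reverse (middleSub v)
  middleSub-reverse v = begin
    tail (init (reverse v))  ≡⟨ cong tail (init-reverse v) ⟩
    tail (reverse (tail v))  ≡⟨ reverse-init (tail v) ⟨
    reverse (init (tail v))  ≡⟨ cong reverse (tail-init v) ⟨
    reverse (tail (init v))  ∎
    where open ≡-Reasoning

  lastSub-reverse : ∀ {A : Set} {n} (v : Vec A (suc (suc n))) → lastSub (reverse v) ≡ reverse (firstSub v)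
  lastSub-reverse v = trans (cong tail (sym (reverse-init v))) (sym (reverse-init (init v)))

  middleSub-init : ∀ {A : Set} {n} (v : Vec A (suc (suc (suc n)))) → middleSub (init v) ≡ firstSub (tail v)
  middleSub-init v = trans (tail-init (init v)) (cong init (tail-init v))

  lastSub-init : ∀ {A : Set} {n} (v : Vec A (suc (suc (suc n)))) → lastSub (init v) ≡ middleSub (tail v)
  lastSub-init v = cong tail (tail-init v)

  module _ (G : Graph) where

    private
      V : Set
      V = Fin (n G)
      E : Set
      E = Fin (m G)

    init-arc : ∀ {ℓ} (vs : Vec V (suc (suc ℓ))) (es : Vec E (suc ℓ)) → IsArc G vs es → IsArc G (init vs) (init es)
    init-arc {ℓ} vs es (joins , nonReversing) = joins′ , nonReversing′
      where
      joins′ : ∀ (i : Fin ℓ) → Joins G (lookup (init es) i) (lookup (init vs) (inject₁ i)) (lookup (init vs) (fsuc i))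
      joins′ i rewrite lookup-init es i | lookup-init vs (inject₁ i) | lookup-init vs (fsuc i) = joins (inject₁ i)
      nonReversing′ : ∀ (i j : Fin ℓ) → toℕ j ≡ suc (toℕ i) → lookup (init es) i ≢ lookup (init es) j
      nonReversing′ i j j≡1+i rewrite lookup-init es i | lookup-init es j =
        nonReversing (inject₁ i) (inject₁ j)
          (trans (toℕ-inject₁ j) (trans j≡1+i (cong suc (sym (toℕ-inject₁ i)))))

    tail-arc : ∀ {ℓ} (vs : Vec V (suc (suc ℓ))) (es : Vec E (suc ℓ)) → IsArc G vs es → IsArc G (tail vs) (tail es)
    tail-arc (v ∷ vs) (e ∷ es) (joins , nonReversing) =
      (λ i → joins (fsuc i)) , (λ i j j≡1+i → nonReversing (fsuc i) (fsuc j) (cong suc j≡1+i))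

    firstSub-arc : ∀ {ℓ} (vs : Vec V (suc (suc (suc ℓ)))) (es : Vec E (suc (suc ℓ))) → IsArc G vs es → IsArc G (firstSub vs) (firstSub es)
    firstSub-arc vs es a = init-arc (init vs) (init es) (init-arc vs es a)

    middleSub-arc : ∀ {ℓ} (vs : Vec V (suc (suc (suc ℓ)))) (es : Vec E (suc (suc ℓ))) → IsArc G vs es → IsArc G (middleSub vs) (middleSub es)
    middleSub-arc vs es a = tail-arc (init vs) (init es) (init-arc vs es a)

    lastSub-arc : ∀ {ℓ} (vs : Vec V (suc (suc (suc ℓ)))) (es : Vec E (suc (suc ℓ))) → IsArc G vs es → IsArc G (lastSub vs) (lastSub es)
    lastSub-arc vs es a = tail-arc (tail vs) (tail es) (tail-arc vs es a)

    linkColourable-mono : ∀ {ℓ k k'} → k ≤ k' → LinkColourable G ℓ k → LinkColourable G ℓ k'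
    linkColourable-mono k≤k' (c , reversal , proper) =
      (λ vs es → inject≤ (c vs es) k≤k') ,
      (λ vs es a → cong (λ x → inject≤ x k≤k') (reversal vs es a)) ,
      (λ vs es a same → proper vs es a (inject≤-injective k≤k' k≤k' _ _ same))

    vertexColouring⇒0-link : ∀ {k} → Colourable G k → LinkColourable G 0 k
    vertexColouring⇒0-link {k} (col , proper) =
      (λ vs es → col (head vs)) , (λ { (v ∷ []) [] _ → refl }) , separated
      where
      separated : ∀ (vs : Vec V 2) (es : Vec E 1) → IsArc G vs es → col (head (init vs)) ≢ col (head (tail vs))
      separated (v₀ ∷ v₁ ∷ []) (e ∷ []) (joins , _) same with joins fzero
      ... | inj₁ e=v₀v₁ = proper e (trans (cong (col ∘ proj₁) e=v₀v₁) (trans same (sym (cong (col ∘ proj₂) e=v₀v₁))))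
      ... | inj₂ e=v₁v₀ = proper e (trans (cong (col ∘ proj₁) e=v₁v₀) (trans (sym same) (sym (cong (col ∘ proj₂) e=v₁v₀))))

    -- L_1(G) is the line graph: colour a 1-link by the colour of its edge.  Two
    -- consecutive edges of a 2-arc are distinct and share their middle vertex.

    edgeColouring⇒1-link : ∀ {k} → EdgeColourable G k → LinkColourable G 1 k
    edgeColouring⇒1-link {k} (col , proper) =
      (λ vs es → col (head es)) , (λ { (v ∷ w ∷ []) (e ∷ []) _ → refl }) , separated
      where
      separated : ∀ (vs : Vec V 3) (es : Vec E 2) → IsArc G vs es → col (head (init es)) ≢ col (head (tail es))
      separated (v₀ ∷ v₁ ∷ v₂ ∷ []) (e₁ ∷ e₂ ∷ []) (joins , nonReversing) =
        proper e₁ e₂ (nonReversing fzero (fsuc fzero) refl) (v₁ , joins-second (joins fzero) , joins-first (joins (fsuc fzero)))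
        where open Incidence G using (joins-first; joins-second)

  -- These are exactly the conditions needed to colour an (ℓ+2)-link from
  -- the colours of its first, middle and last ℓ-sub-links.

  record Compression (k k' : ℕ) : Set where
    field
      squash     : Fin k → Fin k → Fin k → Fin k'
      squash-sym : ∀ a m b → squash a m b ≡ squash b m a
      squash-sep : ∀ a m b d → m ≢ b → squash a m b ≢ squash m b d

  keepMiddle : ∀ {k} → Compression k k
  keepMiddle = record { squash = λ a m b → m ; squash-sym = λ a m b → refl ; squash-sep = λ a m b d m≢b → m≢b }

  module _ (G : Graph) where

    private
      V : Set
      V = Fin (n G)
      E : Set
      E = Fin (m G)

    -- Reversing an (ℓ+2)-arc reverses its middle
    -- sub-arc and swaps (reversed) first and last sub-arcs, so squash-sym gives
    -- reversal invariance; consecutive (ℓ+2)-links share two sub-links and their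
    -- middle sub-links are adjacent in L_ℓ(G), so squash-sep gives properness.

    compressTwoSteps : ∀ {ℓ k k'} → Compression k k' → LinkColourable G ℓ k → LinkColourable G (suc (suc ℓ)) k'
    compressTwoSteps {ℓ} {k} {k'} C (c , reversal , proper) = c′ , reversal′ , proper′
      where
      open Compression C
      sub : (∀ {A : Set} {n} → Vec A (suc (suc n)) → Vec A n) → Vec V (suc (suc (suc ℓ))) → Vec E (suc (suc ℓ)) → Fin k
      sub f vs es = c (f vs) (f es)

      c′ : Vec V (suc (suc (suc ℓ))) → Vec E (suc (suc ℓ)) → Fin k'
      c′ vs es = squash (sub firstSub vs es) (sub middleSub vs es) (sub lastSub vs es)

      reversal′ : ∀ vs es → IsArc G vs es → c′ vs es ≡ c′ (reverse vs) (reverse es)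
      reversal′ vs es a = begin
        squash (sub firstSub vs es) (sub middleSub vs es) (sub lastSub vs es)
          ≡⟨ squash-sym _ _ _ ⟩
        squash (sub lastSub vs es) (sub middleSub vs es) (sub firstSub vs es)
          ≡⟨ cong₂ (λ x y → squash x y (sub firstSub vs es)) lastSubs middleSubs ⟩
        squash (sub firstSub (reverse vs) (reverse es)) (sub middleSub (reverse vs) (reverse es)) (sub firstSub vs es)
          ≡⟨ cong (squash _ _) firstSubs ⟩
        squash (sub firstSub (reverse vs) (reverse es)) (sub middleSub (reverse vs) (reverse es)) (sub lastSub (reverse vs) (reverse es))
          ∎
        where
        open ≡-Reasoning
        lastSubs : sub lastSub vs es ≡ sub firstSub (reverse vs) (reverse es)
        lastSubs = trans (reversal _ _ (lastSub-arc G vs es a)) (sym (cong₂ c (firstSub-reverse vs) (firstSub-reverse es)))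
        middleSubs : sub middleSub vs es ≡ sub middleSub (reverse vs) (reverse es)
        middleSubs = trans (reversal _ _ (middleSub-arc G vs es a)) (sym (cong₂ c (middleSub-reverse vs) (middleSub-reverse es)))
        firstSubs : sub firstSub vs es ≡ sub lastSub (reverse vs) (reverse es)
        firstSubs = trans (reversal _ _ (firstSub-arc G vs es a)) (sym (cong₂ c (lastSub-reverse vs) (lastSub-reverse es)))

      proper′ : ∀ vs es → IsArc G vs es → c′ (init vs) (init es) ≢ c′ (tail vs) (tail es)
      proper′ vs es a same = squash-sep _ _ _ (sub lastSub (tail vs) (tail es)) middle≢last (trans same shifted)
        where
        -- the middle and last sub-links of the initial part are consecutive ℓ-links
        middle≢last : sub middleSub (init vs) (init es) ≢ sub lastSub (init vs) (init es)
        middle≢last eq = proper (middleSub vs) (middleSub es) (middleSub-arc G vs es a)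
          (trans (cong₂ c (sym (tail-init (init vs))) (sym (tail-init (init es)))) eq)
        shifted : c′ (tail vs) (tail es) ≡ squash (sub middleSub (init vs) (init es)) (sub lastSub (init vs) (init es)) (sub lastSub (tail vs) (tail es))
        shifted = cong₂ (λ x y → squash x y (sub lastSub (tail vs) (tail es)))
          (sym (cong₂ c (middleSub-init vs) (middleSub-init es))) (sym (cong₂ c (lastSub-init vs) (lastSub-init es)))

    linkColourable-skipTwo : ∀ {ℓ k} → LinkColourable G ℓ k → LinkColourable G (suc (suc ℓ)) k
    linkColourable-skipTwo = compressTwoSteps keepMiddle

module TwoThirdsCompression where

  open LinkColourings using (Compression)
  open import Data.Nat using (ℕ; zero; suc; _+_; _*_; _≤_; z≤n; s≤s)
  open import Data.Nat.Properties using (+-monoʳ-≤; *-distribˡ-+; module ≤-Reasoning)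
  open import Data.Fin using (Fin) renaming (zero to fzero; suc to fsuc)
  open import Data.Fin.Properties using (suc-injective)
  open import Data.Bool using (Bool; true; false; _∨_)
  open import Data.Bool.Properties using (∨-comm; ∨-identityʳ)
  open import Data.Maybe using (Maybe; just; nothing)
  open import Function using (_∘_)
  open import Relation.Binary.PropositionalEquality

  twoThirdsFloor : ℕ → ℕ
  twoThirdsFloor zero = zero
  twoThirdsFloor (suc zero) = zero
  twoThirdsFloor (suc (suc zero)) = suc zero
  twoThirdsFloor (suc (suc (suc k))) = suc (suc (twoThirdsFloor k))

  three*twoThirdsFloor≤ : ∀ k → 3 * twoThirdsFloor k ≤ 2 * k
  three*twoThirdsFloor≤ zero = z≤n
  three*twoThirdsFloor≤ (suc zero) = z≤n
  three*twoThirdsFloor≤ (suc (suc zero)) = s≤s (s≤s (s≤s z≤n))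
  three*twoThirdsFloor≤ (suc (suc (suc k))) = begin
    3 * (2 + twoThirdsFloor k)  ≡⟨ *-distribˡ-+ 3 2 (twoThirdsFloor k) ⟩
    6 + 3 * twoThirdsFloor k    ≤⟨ +-monoʳ-≤ 6 (three*twoThirdsFloor≤ k) ⟩
    6 + 2 * k                   ≡⟨ *-distribˡ-+ 2 3 k ⟨
    2 * (3 + k)                 ∎
    where open ≤-Reasoning

  -- The old colours are
  -- split into triples {3g, 3g+1, 3g+2} plus at most two leftovers; the new
  -- palette has a spare colour 0 and two colours per triple.  The first two
  -- members of a triple get the two colours of the triple; the third gets one
  -- not used by its neighbours a, b if possible, else the spare colour (this only
  -- happens when {a , b} is the first two members of its own triple).  The
  -- leftover colours go to the spare colour and, if there are two, one more.
  --
  -- The recursion peels off the first triple.  Outer colours are optional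
  -- ('nothing' = a colour of the peeled-off triple, irrelevant deeper down).

  private
    module Construction where

      isFirst isSecond : ∀ {k} → Maybe (Fin (suc (suc (suc k)))) → Bool
      isFirst (just fzero) = true
      isFirst _ = false
      isSecond (just (fsuc fzero)) = true
      isSecond _ = false

      down : ∀ {k} → Maybe (Fin (suc (suc (suc k)))) → Maybe (Fin k)
      down (just (fsuc (fsuc (fsuc x)))) = just x
      down _ = nothing

      -- new colours for the remaining palette, shifted past the triple's two colours
      lift : ∀ {r} → Fin (suc r) → Fin (suc (suc (suc r)))
      lift fzero = fzero
      lift (fsuc x) = fsuc (fsuc (fsuc x))

      -- new colour of the third triple member, given whether a neighbour
      -- carries the first, resp. second, triple member
      third : ∀ {r} → Bool → Bool → Fin (suc (suc (suc r)))
      third false _ = fsuc fzero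
      third true false = fsuc (fsuc fzero)
      third true true = fzero

      squash : ∀ k → Maybe (Fin k) → Fin k → Maybe (Fin k) → Fin (suc (twoThirdsFloor k))
      squash (suc zero) a m b = fzero
      squash (suc (suc zero)) a m b = m
      squash (suc (suc (suc k))) a fzero b = fsuc fzero
      squash (suc (suc (suc k))) a (fsuc fzero) b = fsuc (fsuc fzero)
      squash (suc (suc (suc k))) a (fsuc (fsuc fzero)) b = third (isFirst a ∨ isFirst b) (isSecond a ∨ isSecond b)
      squash (suc (suc (suc k))) a (fsuc (fsuc (fsuc m))) b = lift (squash k (down a) m (down b))

      squash-sym : ∀ k a m b → squash k a m b ≡ squash k b m a
      squash-sym (suc zero) a m b = refl
      squash-sym (suc (suc zero)) a m b = refl
      squash-sym (suc (suc (suc k))) a fzero b = refl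
      squash-sym (suc (suc (suc k))) a (fsuc fzero) b = refl
      squash-sym (suc (suc (suc k))) a (fsuc (fsuc fzero)) b =
        cong₂ third (∨-comm (isFirst a) (isFirst b)) (∨-comm (isSecond a) (isSecond b))
      squash-sym (suc (suc (suc k))) a (fsuc (fsuc (fsuc m))) b = cong lift (squash-sym k (down a) m (down b))

      third-first≢1 : ∀ {r} x y → third {r} (x ∨ true) y ≢ fsuc fzero
      third-first≢1 true false ()
      third-first≢1 true true ()
      third-first≢1 false false ()
      third-first≢1 false true ()

      third-second≢2 : ∀ {r} x y → third {r} x (y ∨ true) ≢ fsuc (fsuc fzero)
      third-second≢2 false y ()
      third-second≢2 true true ()
      third-second≢2 true false ()

      -- a single outer colour cannot be both the first and the second triple member
      third-single≢0 : ∀ {k r} (a : Maybe (Fin (suc (suc (suc k))))) → third {r} (isFirst a) (isSecond a) ≢ fzero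
      third-single≢0 nothing ()
      third-single≢0 (just fzero) ()
      third-single≢0 (just (fsuc fzero)) ()
      third-single≢0 (just (fsuc (fsuc x))) ()

      lift≡third : ∀ {r} z x y → lift {r} z ≡ third x y → third {r} x y ≡ fzero
      lift≡third fzero x y eq = sym eq
      lift≡third (fsuc z) false y ()
      lift≡third (fsuc z) true false ()
      lift≡third (fsuc z) true true ()

      lift≢1 : ∀ {r} z → lift {r} z ≢ fsuc fzero
      lift≢1 fzero ()
      lift≢1 (fsuc z) ()

      lift≢2 : ∀ {r} z → lift {r} z ≢ fsuc (fsuc fzero)
      lift≢2 fzero ()
      lift≢2 (fsuc z) ()

      lift-injective : ∀ {r} z w → lift {r} z ≡ lift w → z ≡ w
      lift-injective fzero fzero eq = refl
      lift-injective (fsuc z) (fsuc w) eq = cong fsuc (suc-injective (suc-injective (suc-injective eq)))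
      lift-injective fzero (fsuc w) ()
      lift-injective (fsuc z) fzero ()

      squash-sep : ∀ k a m b d → m ≢ b → squash k a m (just b) ≢ squash k (just m) b d
      squash-sep (suc zero) a fzero fzero d m≢b _ = m≢b refl
      squash-sep (suc (suc zero)) a m b d m≢b = m≢b
      squash-sep (suc (suc (suc k))) a fzero fzero d m≢b _ = m≢b refl
      squash-sep (suc (suc (suc k))) a fzero (fsuc fzero) d m≢b ()
      squash-sep (suc (suc (suc k))) a fzero (fsuc (fsuc fzero)) d m≢b eq = third-first≢1 false _ (sym eq)
      squash-sep (suc (suc (suc k))) a fzero (fsuc (fsuc (fsuc b))) d m≢b eq = lift≢1 _ (sym eq)
      squash-sep (suc (suc (suc k))) a (fsuc fzero) fzero d m≢b ()
      squash-sep (suc (suc (suc k))) a (fsuc fzero) (fsuc fzero) d m≢b _ = m≢b refl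
      squash-sep (suc (suc (suc k))) a (fsuc fzero) (fsuc (fsuc fzero)) d m≢b eq = third-second≢2 (isFirst d) false (sym eq)
      squash-sep (suc (suc (suc k))) a (fsuc fzero) (fsuc (fsuc (fsuc b))) d m≢b eq = lift≢2 _ (sym eq)
      squash-sep (suc (suc (suc k))) a (fsuc (fsuc fzero)) fzero d m≢b = third-first≢1 (isFirst a) _
      squash-sep (suc (suc (suc k))) a (fsuc (fsuc fzero)) (fsuc fzero) d m≢b = third-second≢2 _ (isSecond a)
      squash-sep (suc (suc (suc k))) a (fsuc (fsuc fzero)) (fsuc (fsuc fzero)) d m≢b _ = m≢b refl
      squash-sep (suc (suc (suc k))) a (fsuc (fsuc fzero)) (fsuc (fsuc (fsuc b))) d m≢b eq =
        third-single≢0 a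
          (subst₂ (λ x y → third x y ≡ fzero) (∨-identityʳ (isFirst a)) (∨-identityʳ (isSecond a))
            (lift≡third _ _ _ (sym eq)))
      squash-sep (suc (suc (suc k))) a (fsuc (fsuc (fsuc m))) fzero d m≢b = lift≢1 _
      squash-sep (suc (suc (suc k))) a (fsuc (fsuc (fsuc m))) (fsuc fzero) d m≢b = lift≢2 _
      squash-sep (suc (suc (suc k))) a (fsuc (fsuc (fsuc m))) (fsuc (fsuc fzero)) d m≢b eq =
        third-single≢0 d (lift≡third _ _ _ eq)
      squash-sep (suc (suc (suc k))) a (fsuc (fsuc (fsuc m))) (fsuc (fsuc (fsuc b))) d m≢b eq =
        squash-sep k (down a) m b (down d) (λ m≡b → m≢b (cong (fsuc ∘ fsuc ∘ fsuc) m≡b)) (lift-injective _ _ eq)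
        where open import Function using (_∘_)

  twoThirdsCompression : ∀ k → Compression k (suc (twoThirdsFloor k))
  twoThirdsCompression k = record
    { squash = λ a m b → Construction.squash k (just a) m (just b)
    ; squash-sym = λ a m b → Construction.squash-sym k (just a) m (just b)
    ; squash-sep = λ a m b d → Construction.squash-sep k (just a) m b (just d)
    }

module ShrinkBound where

  open import Defs using (twoThirdsPow; bound)
  open TwoThirdsCompression using (twoThirdsFloor; three*twoThirdsFloor≤)
  open import Data.Nat as ℕ using (ℕ; zero; suc; _+_; _*_; _≤_; _⊓_; _^_)
  import Data.Nat.Properties as ℕ
  open import Data.Integer as ℤ using (ℤ; +_)
  import Data.Integer.Properties as ℤ
  import Data.Integer.DivMod as ℤ
  open import Data.Rational as ℚ using (ℚ; floor; toℚᵘ)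
  open import Data.Rational.Properties using (toℚᵘ-homo-*; toℚᵘ-fromℚᵘ)
  open import Data.Rational.Unnormalised as ℚᵘ using (ℚᵘ; mkℚᵘ; ↥_; ↧_; *≡*)
  import Data.Rational.Unnormalised.Properties as ℚᵘ
  open import Data.Product using (Σ-syntax; _×_; _,_)
  open import Relation.Binary.PropositionalEquality
  open import Relation.Nullary using (¬_)
  import Data.Nat.Tactic.RingSolver as ℕ-Solver
  import Data.Integer.Tactic.RingSolver as ℤ-Solver

  -- Iterating j times from χ gives the
  -- number of colours obtained for L_{2j}(G) (resp. L_{2j+1}(G) from χ').

  shrink : ℕ → ℕ
  shrink b = b ⊓ suc (twoThirdsFloor b)

  shrinkIter : ℕ → ℕ → ℕ
  shrinkIter χ zero = χ
  shrinkIter χ (suc j) = shrink (shrinkIter χ j)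

  shrinkIter≤ : ∀ χ j → shrinkIter χ j ≤ χ
  shrinkIter≤ χ zero = ℕ.≤-refl
  shrinkIter≤ χ (suc j) = ℕ.≤-trans (ℕ.m⊓n≤m _ _) (shrinkIter≤ χ j)

  three*shrink≤ : ∀ b → 3 * shrink b ≤ 2 * b + 3
  three*shrink≤ b = begin
    3 * (b ⊓ suc (twoThirdsFloor b))  ≤⟨ ℕ.*-monoʳ-≤ 3 (ℕ.m⊓n≤n b _) ⟩
    3 * suc (twoThirdsFloor b)        ≡⟨ ℕ.*-suc 3 (twoThirdsFloor b) ⟩
    3 + 3 * twoThirdsFloor b          ≤⟨ ℕ.+-monoʳ-≤ 3 (three*twoThirdsFloor≤ b) ⟩
    3 + 2 * b                         ≡⟨ ℕ.+-comm 3 (2 * b) ⟩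
    2 * b + 3                         ∎
    where open ℕ.≤-Reasoning

  -- Hence 3^j (b_j - 3) ≤ 2^j (χ - 3) for b_j = shrinkIter χ j, stated without
  -- subtraction.
  shrinkIter-decay : ∀ χ j → shrinkIter χ j * 3 ^ j + 3 * 2 ^ j ≤ χ * 2 ^ j + 3 * 3 ^ j
  shrinkIter-decay χ zero = ℕ.≤-refl
  shrinkIter-decay χ (suc j) = begin
    shrink b * (3 * D) + 3 * (2 * N)  ≡⟨ regroup₁ (shrink b) D N ⟩
    (3 * shrink b) * D + 6 * N        ≤⟨ ℕ.+-monoˡ-≤ (6 * N) (ℕ.*-monoˡ-≤ D (three*shrink≤ b)) ⟩
    (2 * b + 3) * D + 6 * N           ≡⟨ regroup₂ b D N ⟩
    2 * (b * D + 3 * N) + 3 * D       ≤⟨ ℕ.+-monoˡ-≤ (3 * D) (ℕ.*-monoʳ-≤ 2 (shrinkIter-decay χ j)) ⟩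
    2 * (χ * N + 3 * D) + 3 * D       ≡⟨ regroup₃ χ D N ⟩
    χ * (2 * N) + 3 * (3 * D)         ∎
    where
    open ℕ.≤-Reasoning
    b : ℕ
    b = shrinkIter χ j
    D : ℕ
    D = 3 ^ j
    N : ℕ
    N = 2 ^ j
    regroup₁ : ∀ b D N → b * (3 * D) + 3 * (2 * N) ≡ (3 * b) * D + 6 * N
    regroup₁ = ℕ-Solver.solve-∀
    regroup₂ : ∀ b D N → (2 * b + 3) * D + 6 * N ≡ 2 * (b * D + 3 * N) + 3 * D
    regroup₂ = ℕ-Solver.solve-∀
    regroup₃ : ∀ χ D N → 2 * (χ * N + 3 * D) + 3 * D ≡ χ * (2 * N) + 3 * (3 * D)
    regroup₃ = ℕ-Solver.solve-∀

  ≤-div : ∀ z n d → z ℤ.* + suc d ℤ.≤ n → z ℤ.≤ n ℤ./ + suc d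
  ≤-div z n d zd≤n = ℤ.≮⇒≥ q<z-absurd
    where
    q : ℤ
    q = n ℤ./ + suc d
    n<[q+1]d : n ℤ.< ℤ.suc q ℤ.* + suc d
    n<[q+1]d = subst (λ x → n ℤ.< ℤ.suc x ℤ.* + suc d) (sym (ℤ.div-pos-is-/ℕ n (suc d))) (ℤ.n<s[n/ℕd]*d n (suc d))
    q<z-absurd : ¬ (q ℤ.< z)
    q<z-absurd q<z = ℤ.<-irrefl refl (ℤ.<-≤-trans z<q+1 (ℤ.i<j⇒suc[i]≤j q<z))
      where
      z<q+1 : z ℤ.< ℤ.suc q
      z<q+1 = ℤ.*-cancelʳ-<-nonNeg (+ suc d) (ℤ.≤-<-trans zd≤n n<[q+1]d)

  ≤-floor : ∀ q U z → toℚᵘ q ℚᵘ.≃ U → z ℤ.* ↧ U ℤ.≤ ↥ U → z ℤ.≤ floor q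
  ≤-floor (ℚ.mkℚ n d _) (mkℚᵘ a b) z (*≡* n[b+1]≡a[d+1]) z[b+1]≤a =
    ≤-div z n d (ℤ.*-cancelʳ-≤-pos (z ℤ.* + suc d) n (+ suc b) (begin
      z ℤ.* + suc d ℤ.* + suc b   ≡⟨ swap z (+ suc d) (+ suc b) ⟩
      z ℤ.* + suc b ℤ.* + suc d   ≤⟨ ℤ.*-monoʳ-≤-nonNeg (+ suc d) z[b+1]≤a ⟩
      a ℤ.* + suc d               ≡⟨ n[b+1]≡a[d+1] ⟨
      n ℤ.* + suc b               ∎))
    where
    open ℤ.≤-Reasoning
    swap : ∀ x y w → x ℤ.* y ℤ.* w ≡ x ℤ.* w ℤ.* y
    swap = ℤ-Solver.solve-∀

  ↥-* : ∀ p q → ↥ (p ℚᵘ.* q) ≡ ↥ p ℤ.* ↥ q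
  ↥-* (mkℚᵘ _ _) (mkℚᵘ _ _) = refl

  ↧-* : ∀ p q → ↧ (p ℚᵘ.* q) ≡ ↧ p ℤ.* ↧ q
  ↧-* (mkℚᵘ _ b) (mkℚᵘ _ d) = ℤ.pos-* (suc b) (suc d)

  twoThirdsPowᵘ : ℕ → ℚᵘ
  twoThirdsPowᵘ zero = mkℚᵘ (+ 1) 0
  twoThirdsPowᵘ (suc j) = mkℚᵘ (+ 2) 2 ℚᵘ.* twoThirdsPowᵘ j

  ↥twoThirdsPowᵘ : ∀ j → ↥ twoThirdsPowᵘ j ≡ + 2 ^ j
  ↥twoThirdsPowᵘ zero = refl
  ↥twoThirdsPowᵘ (suc j) = trans (↥-* (mkℚᵘ (+ 2) 2) (twoThirdsPowᵘ j)) (trans (cong (+ 2 ℤ.*_) (↥twoThirdsPowᵘ j)) (sym (ℤ.pos-* 2 (2 ^ j))))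

  ↧twoThirdsPowᵘ : ∀ j → ↧ twoThirdsPowᵘ j ≡ + 3 ^ j
  ↧twoThirdsPowᵘ zero = refl
  ↧twoThirdsPowᵘ (suc j) = trans (↧-* (mkℚᵘ (+ 2) 2) (twoThirdsPowᵘ j)) (trans (cong (+ 3 ℤ.*_) (↧twoThirdsPowᵘ j)) (sym (ℤ.pos-* 3 (3 ^ j))))

  twoThirdsPow≃ : ∀ j → toℚᵘ (twoThirdsPow j) ℚᵘ.≃ twoThirdsPowᵘ j
  twoThirdsPow≃ zero = toℚᵘ-fromℚᵘ (mkℚᵘ (+ 1) 0)
  twoThirdsPow≃ (suc j) = ℚᵘ.≃-trans (toℚᵘ-homo-* ((+ 2) ℚ./ 3) (twoThirdsPow j))
    (ℚᵘ.*-cong (toℚᵘ-fromℚᵘ (mkℚᵘ (+ 2) 2)) (twoThirdsPow≃ j))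

  scaledᵘ : ℕ → ℕ → ℚᵘ
  scaledᵘ χ j = twoThirdsPowᵘ j ℚᵘ.* mkℚᵘ (+ χ ℤ.- + 3) 0

  scaled≃ : ∀ χ j → toℚᵘ (twoThirdsPow j ℚ.* ((+ χ ℤ.- + 3) ℚ./ 1)) ℚᵘ.≃ scaledᵘ χ j
  scaled≃ χ j = ℚᵘ.≃-trans (toℚᵘ-homo-* (twoThirdsPow j) _)
    (ℚᵘ.*-cong (twoThirdsPow≃ j) (toℚᵘ-fromℚᵘ (mkℚᵘ (+ χ ℤ.- + 3) 0)))

  shrinkIter-decayℤ : ∀ χ j → (+ shrinkIter χ j ℤ.- + 3) ℤ.* ↧ scaledᵘ χ j ℤ.≤ ↥ scaledᵘ χ j
  shrinkIter-decayℤ χ j = begin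
    (+ b ℤ.- + 3) ℤ.* ↧ scaledᵘ χ j           ≡⟨ cong ((+ b ℤ.- + 3) ℤ.*_) (↧-* (twoThirdsPowᵘ j) (mkℚᵘ (+ χ ℤ.- + 3) 0)) ⟩
    (+ b ℤ.- + 3) ℤ.* (↧ twoThirdsPowᵘ j ℤ.* + 1)
                                              ≡⟨ cong (λ x → (+ b ℤ.- + 3) ℤ.* (x ℤ.* + 1)) (↧twoThirdsPowᵘ j) ⟩
    (+ b ℤ.- + 3) ℤ.* (+ D ℤ.* + 1)           ≡⟨ moveLeft (+ b) (+ D) (+ N) ⟩
    (+ b ℤ.* + D ℤ.+ + 3 ℤ.* + N) ℤ.- + 3 ℤ.* (+ D ℤ.+ + N)
                                              ≤⟨ ℤ.+-monoˡ-≤ (ℤ.- (+ 3 ℤ.* (+ D ℤ.+ + N))) (cast b D N χ N D (shrinkIter-decay χ j)) ⟩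
    (+ χ ℤ.* + N ℤ.+ + 3 ℤ.* + D) ℤ.- + 3 ℤ.* (+ D ℤ.+ + N)
                                              ≡⟨ moveRight (+ χ) (+ D) (+ N) ⟩
    + N ℤ.* (+ χ ℤ.- + 3)                     ≡⟨ cong (ℤ._* (+ χ ℤ.- + 3)) (↥twoThirdsPowᵘ j) ⟨
    ↥ twoThirdsPowᵘ j ℤ.* (+ χ ℤ.- + 3)       ≡⟨ ↥-* (twoThirdsPowᵘ j) (mkℚᵘ (+ χ ℤ.- + 3) 0) ⟨
    ↥ scaledᵘ χ j                             ∎
    where
    open ℤ.≤-Reasoning
    b : ℕ
    b = shrinkIter χ j
    D : ℕ
    D = 3 ^ j
    N : ℕ
    N = 2 ^ j
    moveLeft : ∀ b D N → (b ℤ.- + 3) ℤ.* (D ℤ.* + 1) ≡ (b ℤ.* D ℤ.+ + 3 ℤ.* N) ℤ.- + 3 ℤ.* (D ℤ.+ N)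
    moveLeft = ℤ-Solver.solve-∀
    moveRight : ∀ χ D N → (χ ℤ.* N ℤ.+ + 3 ℤ.* D) ℤ.- + 3 ℤ.* (D ℤ.+ N) ≡ N ℤ.* (χ ℤ.- + 3)
    moveRight = ℤ-Solver.solve-∀
    cast : ∀ x y u v w s → x * y + 3 * u ≤ v * w + 3 * s →
           + x ℤ.* + y ℤ.+ + 3 ℤ.* + u ℤ.≤ + v ℤ.* + w ℤ.+ + 3 ℤ.* + s
    cast x y u v w s le = subst₂ ℤ._≤_ (toℤ x y u) (toℤ v w s) (ℤ.+≤+ le)
      where
      toℤ : ∀ x y u → + (x * y + 3 * u) ≡ + x ℤ.* + y ℤ.+ + 3 ℤ.* + u
      toℤ x y u = trans (ℤ.pos-+ (x * y) _) (cong₂ ℤ._+_ (ℤ.pos-* x y) (ℤ.pos-* 3 u))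

  shrinkIter≤bound : ∀ χ j → + shrinkIter χ j ℤ.≤ bound χ j
  shrinkIter≤bound χ j = ℤ.⊓-glb (ℤ.+≤+ (shrinkIter≤ χ j))
    (subst (ℤ._≤ floor q ℤ.+ + 3) (minus3plus3 (+ shrinkIter χ j))
      (ℤ.+-monoˡ-≤ (+ 3) (≤-floor q (scaledᵘ χ j) (+ shrinkIter χ j ℤ.- + 3) (scaled≃ χ j) (shrinkIter-decayℤ χ j))))
    where
    q : ℚ
    q = twoThirdsPow j ℚ.* ((+ χ ℤ.- + 3) ℚ./ 1)
    minus3plus3 : ∀ x → (x ℤ.- + 3) ℤ.+ + 3 ≡ x
    minus3plus3 = ℤ-Solver.solve-∀

  boundAsNat : ∀ χ j → Σ[ k ∈ ℕ ] ((+ k ≡ bound χ j) × shrinkIter χ j ≤ k)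
  boundAsNat χ j = ℤ.∣ bound χ j ∣ , +∣bound∣ , ℤ.drop‿+≤+ (subst (+ shrinkIter χ j ℤ.≤_) (sym +∣bound∣) (shrinkIter≤bound χ j))
    where
    +∣bound∣ : + ℤ.∣ bound χ j ∣ ≡ bound χ j
    +∣bound∣ = ℤ.0≤i⇒+∣i∣≡i (ℤ.≤-trans (ℤ.+≤+ ℕ.z≤n) (shrinkIter≤bound χ j))

module Counting where

  open import Data.Nat using (ℕ; zero; suc; _+_; _*_; _≤_; _<_; z≤n; s≤s; _⊔_)
  open import Data.Nat.Properties using (≤-trans; n≤1+n; m≤n⇒m≤1+n; m≤m⊔n; m≤n⊔m; +-mono-≤; *-suc; <-irrefl; module ≤-Reasoning)
  open import Data.Fin using (Fin; toℕ) renaming (zero to fzero; suc to fsuc)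
  open import Data.Fin.Properties using (_≟_; pigeonhole; ¬∀⟶∃¬)
  open import Data.List using (List; []; _∷_; length; lookup; filter; foldr)
  open import Data.List.Membership.Propositional using (_∈_; _∉_)
  open import Data.List.Membership.Propositional.Properties using (∈-map⁺; ∈-allFin)
  open import Data.List.Relation.Unary.Any using (here; there; index; any?)
  open import Data.List.Relation.Unary.Any.Properties using (lookup-index)
  open import Data.Product using (∃; _×_; _,_)
  open import Data.Sum using (_⊎_; inj₁; inj₂)
  open import Data.Empty using (⊥-elim)
  open import Function using (_∘_)
  open import Relation.Nullary using (¬_; Dec; yes; no)
  open import Relation.Unary using (Decidable)
  open import Relation.Binary.PropositionalEquality
  import Data.Nat.Tactic.RingSolver as ℕ-Solver

  _∈?_ : ∀ {K} (x : Fin K) (xs : List (Fin K)) → Dec (x ∈ xs)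
  x ∈? xs = any? (x ≟_) xs

  -- Pigeonhole: a list of fewer than K elements of Fin K misses one of them.
  -- (If it contained every x, then x ↦ position of x would be injective from
  -- Fin K into a smaller Fin.)

  missing : ∀ K (xs : List (Fin K)) → length xs < K → ∃ λ x → x ∉ xs
  missing K xs len<K = ¬∀⟶∃¬ K (_∈ xs) (_∈? xs) notAll
    where
    notAll : ¬ (∀ x → x ∈ xs)
    notAll every with pigeonhole len<K (λ x → index (every x))
    ... | i , j , i<j , samePos =
      <-irrefl (cong toℕ (trans (lookup-index (every i)) (trans (cong (lookup xs) samePos) (sym (lookup-index (every j)))))) i<j

  module _ {A : Set} {P Q : A → Set} (P? : Decidable P) (Q? : Decidable Q) (Q⇒P : ∀ y → Q y → P y) where

    length-filter-mono : ∀ xs → length (filter Q? xs) ≤ length (filter P? xs)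
    length-filter-mono [] = z≤n
    length-filter-mono (x ∷ xs) with ih ← length-filter-mono xs | Q? x | P? x
    ... | no _  | no _   = ih
    ... | no _  | yes _  = m≤n⇒m≤1+n ih
    ... | yes q | no ¬p  = ⊥-elim (¬p (Q⇒P x q))
    ... | yes _ | yes _  = s≤s ih

    length-filter-strict : ∀ {y} xs → y ∈ xs → P y → ¬ Q y → suc (length (filter Q? xs)) ≤ length (filter P? xs)
    length-filter-strict (x ∷ xs) (here refl) py ¬qy with Q? x | P? x
    ... | yes qy | _      = ⊥-elim (¬qy qy)
    ... | no _   | no ¬py = ⊥-elim (¬py py)
    ... | no _   | yes _  = s≤s (length-filter-mono xs)
    length-filter-strict (x ∷ xs) (there y∈xs) py ¬qy with ih ← length-filter-strict xs y∈xs py ¬qy | Q? x | P? x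
    ... | no _  | no _   = ih
    ... | no _  | yes _  = m≤n⇒m≤1+n ih
    ... | yes q | no ¬p  = ⊥-elim (¬p (Q⇒P x q))
    ... | yes _ | yes _  = s≤s ih

  -- By induction on K,
  -- deleting the element 0 from the lists and shifting the rest down.

  TwoOf : Set → Set → Set → Set
  TwoOf A B C = (A × B) ⊎ (A × C) ⊎ (B × C)

  private
    dropZero : ∀ {K} → List (Fin (suc K)) → List (Fin K)
    dropZero [] = []
    dropZero (fzero ∷ xs) = dropZero xs
    dropZero (fsuc y ∷ xs) = y ∷ dropZero xs

    dropZero-∈ : ∀ {K} {y : Fin K} (xs : List (Fin (suc K))) → fsuc y ∈ xs → y ∈ dropZero xs
    dropZero-∈ (fzero ∷ xs) (there p) = dropZero-∈ xs p
    dropZero-∈ (fsuc y ∷ xs) (here refl) = here refl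
    dropZero-∈ (fsuc y ∷ xs) (there p) = there (dropZero-∈ xs p)

    indicator : ∀ {A : Set} → Dec A → ℕ
    indicator (yes _) = 1
    indicator (no _) = 0

    length-dropZero : ∀ {K} (xs : List (Fin (suc K))) (d : Dec (fzero ∈ xs)) → indicator d + length (dropZero xs) ≤ length xs
    length-dropZero xs (yes p) = strict xs p
      where
      weak : ∀ xs → length (dropZero xs) ≤ length xs
      weak [] = z≤n
      weak (fzero ∷ xs) = ≤-trans (weak xs) (n≤1+n _)
      weak (fsuc y ∷ xs) = s≤s (weak xs)
      strict : ∀ xs → fzero ∈ xs → suc (length (dropZero xs)) ≤ length xs
      strict (fzero ∷ xs) _ = s≤s (weak xs)
      strict (fsuc y ∷ xs) (there p) = s≤s (strict xs p)
    length-dropZero [] (no _) = z≤n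
    length-dropZero (fzero ∷ xs) (no ¬p) = ⊥-elim (¬p (here refl))
    length-dropZero (fsuc y ∷ xs) (no ¬p) = s≤s (length-dropZero xs (no (¬p ∘ there)))

    twoOf-indicators : ∀ {A B C : Set} (a : Dec A) (b : Dec B) (c : Dec C) → TwoOf A B C → 2 ≤ indicator a + indicator b + indicator c
    twoOf-indicators (yes _) (yes _) _ _ = s≤s (s≤s z≤n)
    twoOf-indicators (yes _) (no _) (yes _) _ = s≤s (s≤s z≤n)
    twoOf-indicators (no _) (yes _) (yes _) _ = s≤s (s≤s z≤n)
    twoOf-indicators _ (no ¬b) (no ¬c) (inj₁ (_ , b)) = ⊥-elim (¬b b)
    twoOf-indicators _ (no ¬b) (no ¬c) (inj₂ (inj₁ (_ , c))) = ⊥-elim (¬c c)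
    twoOf-indicators _ (no ¬b) (no ¬c) (inj₂ (inj₂ (b , _))) = ⊥-elim (¬b b)
    twoOf-indicators (no ¬a) _ (no ¬c) (inj₁ (a , _)) = ⊥-elim (¬a a)
    twoOf-indicators (no ¬a) _ (no ¬c) (inj₂ (inj₁ (a , _))) = ⊥-elim (¬a a)
    twoOf-indicators (no ¬a) _ (no ¬c) (inj₂ (inj₂ (_ , c))) = ⊥-elim (¬c c)
    twoOf-indicators (no ¬a) (no ¬b) _ (inj₁ (a , _)) = ⊥-elim (¬a a)
    twoOf-indicators (no ¬a) (no ¬b) _ (inj₂ (inj₁ (a , _))) = ⊥-elim (¬a a)
    twoOf-indicators (no ¬a) (no ¬b) _ (inj₂ (inj₂ (b , _))) = ⊥-elim (¬b b)

  count-twoOfThree : ∀ K (L₁ L₂ L₃ : List (Fin K)) → (∀ x → TwoOf (x ∈ L₁) (x ∈ L₂) (x ∈ L₃)) →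
                     2 * K ≤ length L₁ + length L₂ + length L₃
  count-twoOfThree zero L₁ L₂ L₃ _ = z≤n
  count-twoOfThree (suc K) L₁ L₂ L₃ twoOf = begin
    2 * suc K                          ≡⟨ *-suc 2 K ⟩
    2 + 2 * K                          ≤⟨ +-mono-≤ (twoOf-indicators d₁ d₂ d₃ (twoOf fzero)) rest ⟩
    (i₁ + i₂ + i₃) + (ℓ₁ + ℓ₂ + ℓ₃)    ≡⟨ regroup i₁ i₂ i₃ ℓ₁ ℓ₂ ℓ₃ ⟩
    (i₁ + ℓ₁) + (i₂ + ℓ₂) + (i₃ + ℓ₃)  ≤⟨ +-mono-≤ (+-mono-≤ (length-dropZero L₁ d₁) (length-dropZero L₂ d₂)) (length-dropZero L₃ d₃) ⟩
    length L₁ + length L₂ + length L₃  ∎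
    where
    open ≤-Reasoning
    d₁ : Dec (fzero ∈ L₁)
    d₁ = fzero ∈? L₁
    d₂ : Dec (fzero ∈ L₂)
    d₂ = fzero ∈? L₂
    d₃ : Dec (fzero ∈ L₃)
    d₃ = fzero ∈? L₃
    i₁ i₂ i₃ : ℕ
    i₁ = indicator d₁
    i₂ = indicator d₂
    i₃ = indicator d₃
    ℓ₁ ℓ₂ ℓ₃ : ℕ
    ℓ₁ = length (dropZero L₁)
    ℓ₂ = length (dropZero L₂)
    ℓ₃ = length (dropZero L₃)
    shift : ∀ {y} → TwoOf (fsuc y ∈ L₁) (fsuc y ∈ L₂) (fsuc y ∈ L₃) → TwoOf (y ∈ dropZero L₁) (y ∈ dropZero L₂) (y ∈ dropZero L₃)
    shift (inj₁ (a , b)) = inj₁ (dropZero-∈ L₁ a , dropZero-∈ L₂ b)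
    shift (inj₂ (inj₁ (a , c))) = inj₂ (inj₁ (dropZero-∈ L₁ a , dropZero-∈ L₃ c))
    shift (inj₂ (inj₂ (b , c))) = inj₂ (inj₂ (dropZero-∈ L₂ b , dropZero-∈ L₃ c))
    rest : 2 * K ≤ ℓ₁ + ℓ₂ + ℓ₃
    rest = count-twoOfThree K (dropZero L₁) (dropZero L₂) (dropZero L₃) (λ y → shift (twoOf (fsuc y)))
    regroup : ∀ i₁ i₂ i₃ a b c → (i₁ + i₂ + i₃) + (a + b + c) ≡ (i₁ + a) + (i₂ + b) + (i₃ + c)
    regroup = ℕ-Solver.solve-∀

  degree≤maxDegree : ∀ G v → degree G v ≤ maxDegree G
  degree≤maxDegree G v = ≤-foldr⊔ (∈-map⁺ (degree G) (∈-allFin v))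
    where
    ≤-foldr⊔ : ∀ {x} {xs : List ℕ} → x ∈ xs → x ≤ foldr _⊔_ 0 xs
    ≤-foldr⊔ {xs = y ∷ _} (here refl) = m≤m⊔n y _
    ≤-foldr⊔ {xs = y ∷ _} (there p) = ≤-trans (≤-foldr⊔ p) (m≤n⊔m y _)

-- Greedy colouring: every graph has a proper (Δ+1)-vertex-colouring.  Colour
-- the vertices in the order 0, 1, …; a vertex has at most Δ neighbours.
module GreedyColouring where

  open Counting using (missing; degree≤maxDegree)
  open import Data.Nat using (ℕ; zero; suc; _≤_; _<_; s≤s)
  open import Data.Nat.Properties using (≤-trans; ≤-refl; ≤-reflexive; ≤-pred; n≤1+n; ≤∧≢⇒<)
  open import Data.Fin using (Fin; toℕ; fromℕ<) renaming (zero to fzero)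
  open import Data.Fin.Properties using (_≟_; toℕ-fromℕ<; toℕ<n; toℕ-injective)
  open import Data.List using (List; length; map; filter; allFin)
  open import Data.List.Properties using (length-map)
  open import Data.List.Membership.Propositional using (_∈_; _∉_)
  open import Data.List.Membership.Propositional.Properties using (∈-filter⁺; ∈-map⁺; ∈-allFin)
  open import Data.Product using (Σ; _,_; proj₁; proj₂)
  open import Data.Sum using (_⊎_; inj₁; inj₂)
  open import Data.Empty using (⊥-elim)
  open import Data.Vec.Functional using (updateAt)
  open import Data.Vec.Functional.Properties using (updateAt-updates; updateAt-minimal)
  open import Relation.Nullary using (Dec; yes; no)
  open import Relation.Nullary.Decidable using (_⊎-dec_)
  open import Relation.Binary.PropositionalEquality

  module _ (G : Graph) where

    open Incidence G using (end₁; end₂)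

    private
      V : Set
      V = Fin (n G)
      E : Set
      E = Fin (m G)
      Δ : ℕ
      Δ = maxDegree G

    ProperBelow : ℕ → (V → Fin (suc Δ)) → Set
    ProperBelow t c = ∀ e → toℕ (end₁ e) < t → toℕ (end₂ e) < t →
                      c (end₁ e) ≢ c (end₂ e)

    private
      edgesAt : V → List E
      edgesAt v = filter (λ e → (end₁ e ≟ v) ⊎-dec (end₂ e ≟ v)) (allFin (m G))

      neighbourVia : V → E → V
      neighbourVia v e with end₁ e ≟ v
      ... | yes _ = end₂ e
      ... | no _ = end₁ e

      neighbourVia-first : ∀ v e → end₁ e ≡ v → neighbourVia v e ≡ end₂ e
      neighbourVia-first v e p with end₁ e ≟ v
      ... | yes _ = refl
      ... | no ¬p = ⊥-elim (¬p p)

      neighbourVia-second : ∀ v e → end₂ e ≡ v → neighbourVia v e ≡ end₁ e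
      neighbourVia-second v e q with end₁ e ≟ v
      ... | yes p = ⊥-elim (loopless G e (trans p (sym q)))
      ... | no _ = refl

      update : (V → Fin (suc Δ)) → V → Fin (suc Δ) → V → Fin (suc Δ)
      update c v x = updateAt c v (λ _ → x)

      update-at : ∀ c v x u → u ≡ v → update c v x u ≡ x
      update-at c v x u refl = updateAt-updates v c

      update-away : ∀ c v x u → u ≢ v → update c v x u ≡ c u
      update-away c v x u u≢v = updateAt-minimal u v c u≢v

      colourNext : ∀ t → (t<n : t < n G) → (c : V → Fin (suc Δ)) → ProperBelow t c → Σ (V → Fin (suc Δ)) (ProperBelow (suc t))
      colourNext t t<n c proper = update c v x , proper′
        where
        v : V
        v = fromℕ< t<n
        nbrColours : List (Fin (suc Δ))
        nbrColours = map (λ e → c (neighbourVia v e)) (edgesAt v)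
        few : length nbrColours < suc Δ
        few = s≤s (≤-trans (≤-reflexive (length-map _ (edgesAt v))) (degree≤maxDegree G v))
        x : Fin (suc Δ)
        x = proj₁ (missing (suc Δ) nbrColours few)
        x-new : x ∉ nbrColours
        x-new = proj₂ (missing (suc Δ) nbrColours few)
        nbrColour : ∀ e → end₁ e ≡ v ⊎ end₂ e ≡ v → c (neighbourVia v e) ∈ nbrColours
        nbrColour e at = ∈-map⁺ (λ e → c (neighbourVia v e)) (∈-filter⁺ _ (∈-allFin e) at)
        earlier : ∀ u → toℕ u < suc t → u ≢ v → toℕ u < t
        earlier u u≤t u≢v = ≤∧≢⇒< (≤-pred u≤t) (λ u=t → u≢v (toℕ-injective (trans u=t (sym (toℕ-fromℕ< t<n)))))
        proper′ : ProperBelow (suc t) (update c v x)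
        proper′ e p<t q<t = byCases (p ≟ v) (q ≟ v)
          where
          p q : V
          p = end₁ e
          q = end₂ e
          byCases : Dec (p ≡ v) → Dec (q ≡ v) → update c v x p ≢ update c v x q
          byCases (yes p=v) (yes q=v) = ⊥-elim (loopless G e (trans p=v (sym q=v)))
          byCases (yes p=v) (no q≢v) same = x-new (subst (_∈ nbrColours)
            (trans (cong c (neighbourVia-first v e p=v)) (trans (sym (update-away c v x q q≢v)) (trans (sym same) (update-at c v x p p=v))))
            (nbrColour e (inj₁ p=v)))
          byCases (no p≢v) (yes q=v) same = x-new (subst (_∈ nbrColours)
            (trans (cong c (neighbourVia-second v e q=v)) (trans (sym (update-away c v x p p≢v)) (trans same (update-at c v x q q=v))))
            (nbrColour e (inj₂ q=v)))
          byCases (no p≢v) (no q≢v) same = proper e (earlier p p<t p≢v) (earlier q q<t q≢v)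
            (trans (sym (update-away c v x p p≢v)) (trans same (update-away c v x q q≢v)))

      colourFirst : ∀ t → t ≤ n G → Σ (V → Fin (suc Δ)) (ProperBelow t)
      colourFirst zero _ = (λ _ → fzero) , λ e ()
      colourFirst (suc t) t<n = let (c , proper) = colourFirst t (≤-trans (n≤1+n t) t<n) in colourNext t t<n c proper

    greedyColouring : Colourable G (suc Δ)
    greedyColouring = let (c , proper) = colourFirst (n G) ≤-refl in c , λ e → proper e (toℕ<n _) (toℕ<n _)

-- Edge colourings in which only the edges of index < t are coloured (the
-- colour of any other edge is irrelevant), the colours present and missing at
-- a vertex, and recolouring a single edge.
module PartialEdgeColouring (G : Graph) (K : ℕ) where

  open Counting using (length-filter-mono; length-filter-strict)
  open import Data.Nat using (ℕ; suc; _≤_; _<_; _<?_)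
  open import Data.Nat.Properties using (≤-trans; ≤-reflexive)
  open import Data.Fin using (Fin; toℕ)
  open import Data.Fin.Properties using (_≟_)
  open import Data.List using (List; length; map; filter; allFin)
  open import Data.List.Properties using (length-map)
  open import Data.List.Membership.Propositional using (_∈_; _∉_)
  open import Data.List.Membership.Propositional.Properties using (∈-filter⁺; ∈-filter⁻; ∈-map⁺; ∈-map⁻; ∈-allFin)
  open import Data.Product using (Σ; _×_; _,_; proj₁; proj₂)
  open import Data.Sum using ([_,_])
  open import Data.Empty using (⊥-elim)
  open import Data.Vec.Functional using (updateAt)
  open import Data.Vec.Functional.Properties using (updateAt-updates; updateAt-minimal)
  open import Relation.Nullary using (¬_; Dec; yes; no)
  open import Relation.Nullary.Decidable using (_⊎-dec_; _×-dec_)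
  open import Relation.Unary using (Decidable)
  open import Relation.Binary.PropositionalEquality hiding ([_])

  open Incidence G public

  private
    V : Set
    V = Fin (n G)
    E : Set
    E = Fin (m G)

  Colouring : Set
  Colouring = E → Fin K

  Coloured : ℕ → E → Set
  Coloured t e = toℕ e < t

  SharedEnd : E → E → Set
  SharedEnd e f = Σ V λ z → Incident G z e × Incident G z f

  ProperOn : (E → Set) → Colouring → Set
  ProperOn S c = ∀ e f → S e → S f → e ≢ f → SharedEnd e f → c e ≢ c f

  ProperUpTo : ℕ → Colouring → Set
  ProperUpTo t = ProperOn (Coloured t)

  incident? : ∀ x e → Dec (Incident G x e)
  incident? x e = (end₁ e ≟ x) ⊎-dec (end₂ e ≟ x)

  private
    colouredAt? : ∀ t x → Decidable (λ e → Coloured t e × Incident G x e)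
    colouredAt? t x e = (toℕ e <? t) ×-dec incident? x e

  abstract
    present : ℕ → Colouring → V → List (Fin K)
    present t c x = map c (filter (colouredAt? t x) (allFin (m G)))

    present-intro : ∀ {t c x e} → Coloured t e → Incident G x e → c e ∈ present t c x
    present-intro {t} {c} {x} {e} ce xe = ∈-map⁺ c (∈-filter⁺ (colouredAt? t x) (∈-allFin e) (ce , xe))

    present-elim : ∀ {t c x α} → α ∈ present t c x → Σ E λ e → Coloured t e × Incident G x e × c e ≡ α
    present-elim {t} {c} {x} α∈ with ∈-map⁻ c α∈
    ... | e , e∈ , α=ce with ∈-filter⁻ (colouredAt? t x) {xs = allFin (m G)} e∈
    ...   | _ , (ce , xe) = e , ce , xe , sym α=ce

    length-present : ∀ t c x → length (present t c x) ≤ degree G x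
    length-present t c x = ≤-trans (≤-reflexive (length-map c (filter (colouredAt? t x) (allFin (m G)))))
      (length-filter-mono (incident? x) (colouredAt? t x) (λ _ → proj₂) (allFin (m G)))

    length-present< : ∀ t c x e → Incident G x e → ¬ Coloured t e → suc (length (present t c x)) ≤ degree G x
    length-present< t c x e xe ¬ce = ≤-trans (≤-reflexive (cong suc (length-map c (filter (colouredAt? t x) (allFin (m G))))))
      (length-filter-strict (incident? x) (colouredAt? t x) (λ _ → proj₂) (allFin (m G)) (∈-allFin e) xe (¬ce ∘ proj₁))
      where open import Function using (_∘_)

  Missing : ℕ → Colouring → V → Fin K → Set
  Missing t c x α = α ∉ present t c x

  missing-unused : ∀ {t c x α e} → Missing t c x α → Coloured t e → Incident G x e → c e ≢ α
  missing-unused {t} {c} {x} miss ce xe ce=α = miss (subst (_∈ present t c x) ce=α (present-intro ce xe))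

  setColour : Colouring → E → Fin K → Colouring
  setColour c g α = updateAt c g (λ _ → α)

  setColour-at : ∀ c g α e → e ≡ g → setColour c g α e ≡ α
  setColour-at c g α e refl = updateAt-updates g c

  setColour-away : ∀ c g α e → e ≢ g → setColour c g α e ≡ c e
  setColour-away c g α e e≢g = updateAt-minimal e g c e≢g

  setColour-proper : ∀ (S : E → Set) c g α →
    (∀ e f → S e → S f → e ≢ g → f ≢ g → e ≢ f → SharedEnd e f → c e ≢ c f) →
    (∀ e z → S e → e ≢ g → Incident G z g → Incident G z e → c e ≢ α) →
    ProperOn S (setColour c g α)
  setColour-proper S c g α proper unused e f se sf e≢f (z , ze , zf) = byCases (e ≟ g) (f ≟ g)
    where
    byCases : Dec (e ≡ g) → Dec (f ≡ g) → setColour c g α e ≢ setColour c g α f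
    byCases (yes e=g) (yes f=g) = ⊥-elim (e≢f (trans e=g (sym f=g)))
    byCases (yes e=g) (no f≢g) same = unused f z sf f≢g (subst (Incident G z) e=g ze) zf
      (trans (sym (setColour-away c g α f f≢g)) (trans (sym same) (setColour-at c g α e e=g)))
    byCases (no e≢g) (yes f=g) same = unused e z se e≢g (subst (Incident G z) f=g zf) ze
      (trans (sym (setColour-away c g α e e≢g)) (trans same (setColour-at c g α f f=g)))
    byCases (no e≢g) (no f≢g) same = proper e f se sf e≢g f≢g e≢f (z , ze , zf)
      (trans (sym (setColour-away c g α e e≢g)) (trans same (setColour-away c g α f f≢g)))

  colourNext : ∀ {t} c g α → toℕ g ≡ t → ProperUpTo t c →
    Missing t c (end₁ g) α → Missing t c (end₂ g) α → ProperUpTo (suc t) (setColour c g α)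
  colourNext {t} c g α g=t proper miss₁ miss₂ = setColour-proper (Coloured (suc t)) c g α
    (λ e f ce cf e≢g f≢g → proper e f (earlier ce e≢g) (earlier cf f≢g))
    (λ e z ce e≢g zg ze → [ (λ z=₁ → missing-unused (subst (λ y → Missing t c y α) (sym z=₁) miss₁) (earlier ce e≢g) ze)
                          , (λ z=₂ → missing-unused (subst (λ y → Missing t c y α) (sym z=₂) miss₂) (earlier ce e≢g) ze) ]
                          (incident-ends zg))
    where
    open import Data.Nat.Properties using (≤∧≢⇒<; ≤-pred)
    open import Data.Fin.Properties using (toℕ-injective)
    earlier : ∀ {e} → Coloured (suc t) e → e ≢ g → Coloured t e
    earlier ce e≢g = ≤∧≢⇒< (≤-pred ce) (λ e=t → e≢g (toℕ-injective (trans e=t (sym g=t))))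

  recolour : ∀ {t} c g v w β → ProperUpTo t c → Joins G g v w →
    Missing t c v β → Missing t c w β → ProperUpTo t (setColour c g β)
  recolour {t} c g v w β proper joins miss-v miss-w = setColour-proper (Coloured t) c g β
    (λ e f ce cf _ _ → proper e f ce cf)
    (λ e z ce _ zg ze → [ (λ z=v → missing-unused (subst (λ y → Missing t c y β) (sym z=v) miss-v) ce ze)
                        , (λ z=w → missing-unused (subst (λ y → Missing t c y β) (sym z=w) miss-w) ce ze) ]
                        (joins-incident joins zg))

module KempeChains (G : Graph) (K : ℕ) where

  open Counting using (_∈?_)
  open import Data.Nat as ℕ using (ℕ; zero; suc; _+_; _≤_; _<_; z≤n; s≤s; _≤?_; _<?_)
  import Data.Nat.Properties as ℕ
  open import Data.Fin using (Fin; toℕ; fromℕ<)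
  open import Data.Fin.Properties using (_≟_; toℕ-fromℕ<; toℕ<n; pigeonhole; any?)
  open import Data.Fin.Permutation.Components using (transpose)
  open import Data.List.Membership.Propositional using (_∈_)
  open import Data.Product using (Σ; _×_; _,_; proj₁; proj₂)
  open import Data.Sum using (_⊎_; inj₁; inj₂)
  open import Data.Empty using (⊥; ⊥-elim)
  open import Function using (_∘_)
  open import Relation.Nullary using (¬_; Dec; yes; no)
  open import Relation.Nullary.Decidable using (dec-true; dec-false; _⊎-dec_)
  open import Relation.Unary using (Decidable)
  open import Relation.Binary.PropositionalEquality

  open PartialEdgeColouring G K

  private
    V : Set
    V = Fin (n G)
    E : Set
    E = Fin (m G)

  module ColourPair (β γ : Fin K) (β≢γ : β ≢ γ) where

    InPair : Fin K → Set
    InPair δ = δ ≡ β ⊎ δ ≡ γ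

    inPair? : ∀ δ → Dec (InPair δ)
    inPair? δ = (δ ≟ β) ⊎-dec (δ ≟ γ)

    swap : Fin K → Fin K
    swap = transpose β γ

    swap-β : swap β ≡ γ
    swap-β rewrite dec-true (β ≟ β) refl = refl

    swap-γ : swap γ ≡ β
    swap-γ rewrite dec-false (γ ≟ β) (β≢γ ∘ sym) | dec-true (γ ≟ γ) refl = refl

    swap-other : ∀ δ → ¬ InPair δ → swap δ ≡ δ
    swap-other δ ∉pair rewrite dec-false (δ ≟ β) (∉pair ∘ inj₁) | dec-false (δ ≟ γ) (∉pair ∘ inj₂) = refl

    swap-inPair : ∀ δ → InPair δ → InPair (swap δ)
    swap-inPair δ (inj₁ refl) = inj₂ swap-β
    swap-inPair δ (inj₂ refl) = inj₁ swap-γ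

    swap-involutive : ∀ δ → swap (swap δ) ≡ δ
    swap-involutive δ with inPair? δ
    ... | yes (inj₁ refl) = trans (cong swap swap-β) swap-γ
    ... | yes (inj₂ refl) = trans (cong swap swap-γ) swap-β
    ... | no δ∉ = trans (cong swap (swap-other δ δ∉)) (swap-other δ δ∉)

    swap-injective : ∀ δ δ′ → swap δ ≡ swap δ′ → δ ≡ δ′
    swap-injective δ δ′ eq = trans (sym (swap-involutive δ)) (trans (cong swap eq) (swap-involutive δ′))

    colourAt : ℕ → Fin K
    colourAt zero = γ
    colourAt (suc zero) = β
    colourAt (suc (suc i)) = colourAt i

    colourAt-step : ∀ i → (colourAt i ≡ γ × colourAt (suc i) ≡ β) ⊎ (colourAt i ≡ β × colourAt (suc i) ≡ γ)
    colourAt-step zero = inj₁ (refl , refl)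
    colourAt-step (suc zero) = inj₂ (refl , refl)
    colourAt-step (suc (suc i)) = colourAt-step i

    colourAt-alternates : ∀ i → colourAt i ≢ colourAt (suc i)
    colourAt-alternates i with colourAt-step i
    ... | inj₁ (i=γ , i+1=β) = λ eq → β≢γ (trans (sym i+1=β) (trans (sym eq) i=γ))
    ... | inj₂ (i=β , i+1=γ) = λ eq → β≢γ (trans (sym i=β) (trans eq i+1=γ))

    colourAt-inPair : ∀ i → InPair (colourAt i)
    colourAt-inPair i with colourAt-step i
    ... | inj₁ (i=γ , _) = inj₂ i=γ
    ... | inj₂ (i=β , _) = inj₁ i=β

    inPair-cases : ∀ i δ → InPair δ → δ ≡ colourAt i ⊎ δ ≡ colourAt (suc i)
    inPair-cases i δ pair with colourAt-step i | pair
    ... | inj₁ (i=γ , _) | inj₂ δ=γ = inj₁ (trans δ=γ (sym i=γ))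
    ... | inj₁ (_ , i+1=β) | inj₁ δ=β = inj₂ (trans δ=β (sym i+1=β))
    ... | inj₂ (i=β , _) | inj₁ δ=β = inj₁ (trans δ=β (sym i=β))
    ... | inj₂ (_ , i+1=γ) | inj₂ δ=γ = inj₂ (trans δ=γ (sym i+1=γ))

  module KempeSwap (t : ℕ) (c : Colouring) (proper : ProperUpTo t c) (β γ : Fin K) (β≢γ : β ≢ γ)
                   (S : V → Set) (S? : Decidable S)
                   (closed : ∀ e → Coloured t e → ColourPair.InPair β γ β≢γ (c e) → ∀ z → Incident G z e → S z → S (end₁ e) × S (end₂ e)) where

    open ColourPair β γ β≢γ

    swapped : Colouring
    swapped e with S? (end₁ e)
    ... | yes _ = swap (c e)
    ... | no _ = c e

    private
      swapped-in : ∀ e → S (end₁ e) → swapped e ≡ swap (c e)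
      swapped-in e s with S? (end₁ e)
      ... | yes _ = refl
      ... | no ¬s = ⊥-elim (¬s s)

      swapped-out : ∀ e → ¬ S (end₁ e) → swapped e ≡ c e
      swapped-out e ¬s with S? (end₁ e)
      ... | yes s = ⊥-elim (¬s s)
      ... | no _ = refl

      -- a β/γ-edge touches S iff its first end lies in S
      toS : ∀ e → Coloured t e → InPair (c e) → ∀ z → Incident G z e → S (end₁ e) → S z
      toS e ce pair z ze s with closed e ce pair (end₁ e) (inj₁ refl) s | incident-ends ze
      ... | s₁ , _ | inj₁ z=₁ = subst S (sym z=₁) s₁
      ... | _ , s₂ | inj₂ z=₂ = subst S (sym z=₂) s₂

      fromS : ∀ e → Coloured t e → InPair (c e) → ∀ z → Incident G z e → S z → S (end₁ e)
      fromS e ce pair z ze s = proj₁ (closed e ce pair z ze s)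

    swapped-unpaired : ∀ e → ¬ InPair (c e) → swapped e ≡ c e
    swapped-unpaired e unpaired with S? (end₁ e)
    ... | yes _ = swap-other (c e) unpaired
    ... | no _ = refl

    swapped-proper : ProperUpTo t swapped
    swapped-proper e f ce cf e≢f (z , ze , zf) same = byCases (S? (end₁ e)) (S? (end₁ f))
      where
      -- e is swapped, f is not: then c e was not in the pair, or f would touch S
      mixed : ∀ e f → Coloured t e → Coloured t f → e ≢ f → Incident G z e → Incident G z f →
              S (end₁ e) → ¬ S (end₁ f) → swap (c e) ≡ c f → ⊥
      mixed e f ce cf e≢f ze zf se ¬sf eq with inPair? (c e)
      ... | yes pair = ¬sf (fromS f cf (subst InPair eq (swap-inPair (c e) pair)) z zf (toS e ce pair z ze se))
      ... | no unpaired = proper e f ce cf e≢f (z , ze , zf) (trans (sym (swap-other (c e) unpaired)) eq)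
      byCases : Dec (S (end₁ e)) → Dec (S (end₁ f)) → ⊥
      byCases (yes se) (yes sf) = proper e f ce cf e≢f (z , ze , zf)
        (swap-injective (c e) (c f) (trans (sym (swapped-in e se)) (trans same (swapped-in f sf))))
      byCases (no ¬se) (no ¬sf) = proper e f ce cf e≢f (z , ze , zf)
        (trans (sym (swapped-out e ¬se)) (trans same (swapped-out f ¬sf)))
      byCases (yes se) (no ¬sf) = mixed e f ce cf e≢f ze zf se ¬sf (trans (sym (swapped-in e se)) (trans same (swapped-out f ¬sf)))
      byCases (no ¬se) (yes sf) = mixed f e cf ce (e≢f ∘ sym) zf ze sf ¬se (trans (sym (swapped-in f sf)) (trans (sym same) (swapped-out e ¬se)))

    missing-inside : ∀ z δ → S z → InPair δ → Missing t c z δ → Missing t swapped z (swap δ)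
    missing-inside z δ s pair miss present = let (e , ce , ze , eq) = present-elim present in byCases e ce ze eq (S? (end₁ e))
      where
      byCases : ∀ e → Coloured t e → Incident G z e → swapped e ≡ swap δ → Dec (S (end₁ e)) → ⊥
      byCases e ce ze eq (yes se) = missing-unused miss ce ze (swap-injective (c e) δ (trans (sym (swapped-in e se)) eq))
      byCases e ce ze eq (no ¬se) =
        ¬se (fromS e ce (subst InPair (sym (trans (sym (swapped-out e ¬se)) eq)) (swap-inPair δ pair)) z ze s)

    missing-outside : ∀ z δ → ¬ S z → Missing t c z δ → Missing t swapped z δ
    missing-outside z δ ¬s miss present = let (e , ce , ze , eq) = present-elim present in byCases e ce ze eq (S? (end₁ e))
      where
      byCases : ∀ e → Coloured t e → Incident G z e → swapped e ≡ δ → Dec (S (end₁ e)) → ⊥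
      byCases e ce ze eq (no ¬se) = missing-unused miss ce ze (trans (sym (swapped-out e ¬se)) eq)
      byCases e ce ze eq (yes se) with inPair? (c e)
      ... | yes pair = ¬s (toS e ce pair z ze se)
      ... | no unpaired = missing-unused miss ce ze (trans (sym (swap-other (c e) unpaired)) (trans (sym (swapped-in e se)) eq))

    missing-unpaired : ∀ z δ → ¬ InPair δ → Missing t c z δ → Missing t swapped z δ
    missing-unpaired z δ unpaired miss present = let (e , ce , ze , eq) = present-elim present in byCases e ce ze eq (S? (end₁ e))
      where
      byCases : ∀ e → Coloured t e → Incident G z e → swapped e ≡ δ → Dec (S (end₁ e)) → ⊥
      byCases e ce ze eq (no ¬se) = missing-unused miss ce ze (trans (sym (swapped-out e ¬se)) eq)
      byCases e ce ze eq (yes se) with inPair? (c e)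
      ... | yes pair = unpaired (subst InPair (trans (sym (swapped-in e se)) eq) (swap-inPair (c e) pair))
      ... | no unpaired′ = missing-unused miss ce ze (trans (sym (swap-other (c e) unpaired′)) (trans (sym (swapped-in e se)) eq))

  module KempeChain (t : ℕ) (c : Colouring) (proper : ProperUpTo t c) (β γ : Fin K) (β≢γ : β ≢ γ)
                    (u : V) (miss-u : Missing t c u β) where

    open ColourPair β γ β≢γ

    sameColour-unique : ∀ z e f → Coloured t e → Coloured t f → Incident G z e → Incident G z f → c e ≡ c f → e ≡ f
    sameColour-unique z e f ce cf ze zf same with e ≟ f
    ... | yes e=f = e=f
    ... | no e≢f = ⊥-elim (proper e f ce cf e≢f (z , ze , zf) same)

    record Chain : Set where
      field
        len : ℕ
        vertex : ℕ → V
        edge : ∀ i → i < len → E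
        starts : vertex 0 ≡ u
        edge-coloured : ∀ i (i<len : i < len) → Coloured t (edge i i<len)
        edge-colour : ∀ i (i<len : i < len) → c (edge i i<len) ≡ colourAt i
        edge-joins : ∀ i (i<len : i < len) → Joins G (edge i i<len) (vertex i) (vertex (suc i))
        distinct : ∀ i j → i ≤ len → j ≤ len → vertex i ≡ vertex j → i ≡ j

    Continuation : Chain → Set
    Continuation ch = Σ E λ e → Coloured t e × Incident G (Chain.vertex ch (Chain.len ch)) e × c e ≡ colourAt (Chain.len ch)

    module _ (ch : Chain) where
      open Chain ch

      data PairEdgeAt (j : ℕ) (e : E) : Set where
        next : (j<len : j < len) → e ≡ edge j j<len → PairEdgeAt j e
        previous : ∀ j′ (j′<len : j′ < len) → j ≡ suc j′ → e ≡ edge j′ j′<len → PairEdgeAt j e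
        beyond : j ≡ len → c e ≡ colourAt len → PairEdgeAt j e

      pairEdgeAt : ∀ j → j ≤ len → ∀ e → Coloured t e → Incident G (vertex j) e → InPair (c e) → PairEdgeAt j e
      pairEdgeAt j j≤len e ce ze pair with inPair-cases j (c e) pair
      pairEdgeAt j j≤len e ce ze pair | inj₁ colour-j with ℕ.m≤n⇒m<n∨m≡n j≤len
      ... | inj₁ j<len = next j<len (sameColour-unique (vertex j) e _ ce (edge-coloured j j<len) ze
                           (joins-first (edge-joins j j<len)) (trans colour-j (sym (edge-colour j j<len))))
      ... | inj₂ j=len = beyond j=len (trans colour-j (cong colourAt j=len))
      pairEdgeAt zero _ e ce ze pair | inj₂ colour-β =
        ⊥-elim (missing-unused miss-u ce (subst (λ w → Incident G w e) starts ze) colour-β)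
      pairEdgeAt (suc j′) j<len e ce ze pair | inj₂ colour-j′ =
        previous j′ j<len refl (sameColour-unique (vertex (suc j′)) e _ ce (edge-coloured j′ j<len) ze
          (joins-second (edge-joins j′ j<len)) (trans colour-j′ (sym (edge-colour j′ j<len))))

      continuation-fresh : ∀ e y → Coloured t e → c e ≡ colourAt len → Joins G e (vertex len) y → ∀ j → j ≤ len → vertex j ≢ y
      continuation-fresh e y ce colour joins j j≤len vj=y
        with pairEdgeAt j j≤len e ce (subst (λ w → Incident G w e) (sym vj=y) (joins-second joins))
                        (subst InPair (sym colour) (colourAt-inPair len))
      ... | next j<len refl with joins-incident (edge-joins j j<len) (joins-first joins)
      ...   | inj₁ vlen=vj = ℕ.<-irrefl (sym (distinct len j ℕ.≤-refl j≤len vlen=vj)) j<len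
      ...   | inj₂ vlen=vj+1 = colourAt-alternates j (trans (sym (edge-colour j j<len))
                                 (trans colour (cong colourAt (distinct len (suc j) ℕ.≤-refl j<len vlen=vj+1))))
      continuation-fresh e y ce colour joins j j≤len vj=y | previous j′ j′<len refl refl
        with joins-incident (edge-joins j′ j′<len) (joins-first joins)
      ...   | inj₁ vlen=vj′ = ℕ.<-irrefl (sym (distinct len j′ ℕ.≤-refl (ℕ.<⇒≤ j′<len) vlen=vj′)) j′<len
      ...   | inj₂ vlen=vj = joins-distinct joins (trans vlen=vj vj=y)
      continuation-fresh e y ce colour joins j j≤len vj=y | beyond refl _ = joins-distinct joins vj=y

      module Extend (e : E) (ce : Coloured t e) (ze : Incident G (vertex len) e) (colour : c e ≡ colourAt len) where

        y : V
        y = proj₁ (otherEnd ze)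
        joins : Joins G e (vertex len) y
        joins = proj₂ (otherEnd ze)

        vertex′ : ℕ → V
        vertex′ i with i ≤? len
        ... | yes _ = vertex i
        ... | no _ = y

        vertex′-old : ∀ i → i ≤ len → vertex′ i ≡ vertex i
        vertex′-old i i≤len with i ≤? len
        ... | yes _ = refl
        ... | no i≰len = ⊥-elim (i≰len i≤len)

        vertex′-new : ∀ i → i ≤ suc len → ¬ i ≤ len → i ≡ suc len × vertex′ i ≡ y
        vertex′-new i i≤1+len i≰len with i ≤? len
        ... | yes i≤len = ⊥-elim (i≰len i≤len)
        ... | no _ = ℕ.≤-antisym i≤1+len (ℕ.≰⇒> i≰len) , refl

        edge′ : ∀ i → i < suc len → E
        edge′ i _ with i <? len
        ... | yes i<len = edge i i<len
        ... | no _ = e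

        edge′-cases : ∀ i (i<1+len : i < suc len) →
          (Σ (i < len) λ i<len → edge′ i i<1+len ≡ edge i i<len) ⊎ (i ≡ len × edge′ i i<1+len ≡ e)
        edge′-cases i i<1+len with i <? len
        ... | yes i<len = inj₁ (i<len , refl)
        ... | no i≮len = inj₂ (ℕ.≤-antisym (ℕ.≤-pred i<1+len) (ℕ.≮⇒≥ i≮len) , refl)

        coloured′ : ∀ i (i<1+len : i < suc len) → Coloured t (edge′ i i<1+len)
        coloured′ i i<1+len with edge′-cases i i<1+len
        ... | inj₁ (i<len , eq) = subst (Coloured t) (sym eq) (edge-coloured i i<len)
        ... | inj₂ (_ , eq) = subst (Coloured t) (sym eq) ce

        colour′ : ∀ i (i<1+len : i < suc len) → c (edge′ i i<1+len) ≡ colourAt i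
        colour′ i i<1+len with edge′-cases i i<1+len
        ... | inj₁ (i<len , eq) = trans (cong c eq) (edge-colour i i<len)
        ... | inj₂ (i=len , eq) = trans (cong c eq) (trans colour (cong colourAt (sym i=len)))

        joins′ : ∀ i (i<1+len : i < suc len) → Joins G (edge′ i i<1+len) (vertex′ i) (vertex′ (suc i))
        joins′ i i<1+len with edge′-cases i i<1+len
        ... | inj₁ (i<len , eq) = subst₂ (Joins G (edge′ i i<1+len)) (sym (vertex′-old i (ℕ.<⇒≤ i<len))) (sym (vertex′-old (suc i) i<len))
                                    (subst (λ f → Joins G f (vertex i) (vertex (suc i))) (sym eq) (edge-joins i i<len))
        ... | inj₂ (refl , eq) = subst₂ (Joins G (edge′ i i<1+len)) (sym (vertex′-old len ℕ.≤-refl))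
                                    (sym (proj₂ (vertex′-new (suc len) ℕ.≤-refl (ℕ.<-irrefl refl))))
                                    (subst (λ f → Joins G f (vertex len) y) (sym eq) joins)

        distinct′ : ∀ i j → i ≤ suc len → j ≤ suc len → vertex′ i ≡ vertex′ j → i ≡ j
        distinct′ i j i≤ j≤ same = byCases (i ≤? len) (j ≤? len)
          where
          byCases : Dec (i ≤ len) → Dec (j ≤ len) → i ≡ j
          byCases (yes i≤len) (yes j≤len) =
            distinct i j i≤len j≤len (trans (sym (vertex′-old i i≤len)) (trans same (vertex′-old j j≤len)))
          byCases (yes i≤len) (no j≰len) = ⊥-elim (continuation-fresh e y ce colour joins i i≤len
            (trans (sym (vertex′-old i i≤len)) (trans same (proj₂ (vertex′-new j j≤ j≰len)))))
          byCases (no i≰len) (yes j≤len) = ⊥-elim (continuation-fresh e y ce colour joins j j≤len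
            (trans (sym (vertex′-old j j≤len)) (trans (sym same) (proj₂ (vertex′-new i i≤ i≰len)))))
          byCases (no i≰len) (no j≰len) = trans (proj₁ (vertex′-new i i≤ i≰len)) (sym (proj₁ (vertex′-new j j≤ j≰len)))

        extended : Chain
        extended = record
          { len = suc len ; vertex = vertex′ ; edge = edge′ ; starts = trans (vertex′-old 0 z≤n) starts
          ; edge-coloured = coloured′ ; edge-colour = colour′ ; edge-joins = joins′ ; distinct = distinct′ }

      extend : Continuation ch → Σ Chain λ ch′ → Chain.len ch′ ≡ suc len
      extend (e , ce , ze , colour) = Extend.extended e ce ze colour , refl

      -- A chain has fewer edges than G has vertices (its vertices are distinct).
      len<n : len < n G
      len<n with suc len ≤? n G
      ... | yes len<n = len<n
      ... | no len≮n with pigeonhole (ℕ.≰⇒> len≮n) (λ i → vertex (toℕ i))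
      ...   | i , j , i<j , same = ⊥-elim (ℕ.<⇒≢ i<j
              (distinct (toℕ i) (toℕ j) (ℕ.≤-pred (toℕ<n i)) (ℕ.≤-pred (toℕ<n j)) same))

      continuation? : Dec (Continuation ch)
      continuation? with colourAt len ∈? present t c (vertex len)
      ... | yes present = yes (present-elim present)
      ... | no absent = no λ (e , ce , ze , colour) → absent (subst (_∈ present t c (vertex len)) colour (present-intro ce ze))

    -- The maximal chain: start with the trivial chain at u and extend until no
    -- continuation exists, which happens within n G steps.
    private
      trivial : Chain
      trivial = record
        { len = 0 ; vertex = λ _ → u ; edge = λ _ () ; starts = refl
        ; edge-coloured = λ _ () ; edge-colour = λ _ () ; edge-joins = λ _ ()
        ; distinct = λ { zero zero _ _ _ → refl } }

      grow : ∀ fuel (ch : Chain) → n G ≤ Chain.len ch + fuel → Σ Chain λ ch′ → ¬ Continuation ch′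
      grow fuel ch enough with continuation? ch
      ... | no stuck = ch , stuck
      ... | yes cont with extend ch cont | fuel
      ...   | _ , _ | zero = ⊥-elim (ℕ.<-irrefl refl (ℕ.<-≤-trans (len<n ch) (subst (n G ≤_) (ℕ.+-identityʳ _) enough)))
      ...   | ch′ , len′ | suc fuel′ = grow fuel′ ch′ (subst (λ l → n G ≤ l + fuel′) (sym len′) (subst (n G ≤_) (ℕ.+-suc _ fuel′) enough))

    abstract
      maximal : Σ Chain λ ch → ¬ Continuation ch
      maximal = grow (n G) trivial ℕ.≤-refl

    open Chain (proj₁ maximal)

    OnChain : V → Set
    OnChain z = Σ (Fin (suc len)) λ i → vertex (toℕ i) ≡ z

    onChain? : Decidable OnChain
    onChain? z = any? (λ i → vertex (toℕ i) ≟ z)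

    onChain : ∀ k → k ≤ len → OnChain (vertex k)
    onChain k k≤len = fromℕ< (s≤s k≤len) , cong vertex (toℕ-fromℕ< (s≤s k≤len))

    u-onChain : OnChain u
    u-onChain = subst OnChain starts (onChain 0 z≤n)

    chainEdge-ends : ∀ j (j<len : j < len) → OnChain (end₁ (edge j j<len)) × OnChain (end₂ (edge j j<len))
    chainEdge-ends j j<len = atEnd (inj₁ refl) , atEnd (inj₂ refl)
      where
      atEnd : ∀ {w} → Incident G w (edge j j<len) → OnChain w
      atEnd wₑ with joins-incident (edge-joins j j<len) wₑ
      ... | inj₁ w=vj = subst OnChain (sym w=vj) (onChain j (ℕ.<⇒≤ j<len))
      ... | inj₂ w=vj+1 = subst OnChain (sym w=vj+1) (onChain (suc j) j<len)

    -- Every β/γ-edge touching the chain is a chain edge (there is no continuation).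
    onChain-closed : ∀ e → Coloured t e → InPair (c e) → ∀ z → Incident G z e → OnChain z → OnChain (end₁ e) × OnChain (end₂ e)
    onChain-closed e ce pair z ze (i , vi=z) with pairEdgeAt (proj₁ maximal) (toℕ i) (ℕ.≤-pred (toℕ<n i)) e ce
                                                    (subst (λ w → Incident G w e) (sym vi=z) ze) pair
    ... | next j<len refl = chainEdge-ends _ j<len
    ... | previous j′ j′<len _ refl = chainEdge-ends j′ j′<len
    ... | beyond i=len colour = ⊥-elim (proj₂ maximal (e , ce , subst (λ j → Incident G (vertex j) e) i=len
                                   (subst (λ w → Incident G w e) (sym vi=z) ze) , colour))

    onChain-missing : ∀ z → OnChain z → z ≢ u → Missing t c z β ⊎ Missing t c z γ → z ≡ vertex len
    onChain-missing z (i , vi=z) z≢u miss = atIndex (toℕ i) (ℕ.≤-pred (toℕ<n i)) vi=z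
      where
      atIndex : ∀ j → j ≤ len → vertex j ≡ z → z ≡ vertex len
      atIndex zero _ v0=z = ⊥-elim (z≢u (trans (sym v0=z) starts))
      atIndex (suc j′) j≤len vj=z with ℕ.m≤n⇒m<n∨m≡n j≤len
      ... | inj₂ j=len = trans (sym vj=z) (cong vertex j=len)
      ... | inj₁ j<len = ⊥-elim (bothPresent (missing-colour miss))
        where
        j′<len : j′ < len
        j′<len = ℕ.<-trans (ℕ.n<1+n j′) j<len
        missing-colour : Missing t c z β ⊎ Missing t c z γ → Σ (Fin K) λ δ → InPair δ × Missing t c z δ
        missing-colour (inj₁ m) = β , inj₁ refl , m
        missing-colour (inj₂ m) = γ , inj₂ refl , m
        bothPresent : (Σ (Fin K) λ δ → InPair δ × Missing t c z δ) → ⊥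
        bothPresent (δ , pair , miss-δ) with inPair-cases (suc j′) δ pair
        ... | inj₁ δ=next = missing-unused miss-δ (edge-coloured (suc j′) j<len)
                (subst (λ w → Incident G w (edge (suc j′) j<len)) vj=z (joins-first (edge-joins (suc j′) j<len)))
                (trans (edge-colour (suc j′) j<len) (sym δ=next))
        ... | inj₂ δ=previous = missing-unused miss-δ (edge-coloured j′ j′<len)
                (subst (λ w → Incident G w (edge j′ j′<len)) vj=z (joins-second (edge-joins j′ j′<len)))
                (trans (edge-colour j′ j′<len) (sym δ=previous))

module Shannon (G : Graph) (K : ℕ) (enough : 3 * maxDegree G ≤ 2 * K + 1) where

  open Counting using (missing; TwoOf; count-twoOfThree; length-filter-strict; degree≤maxDegree; _∈?_)
  open import Data.Nat using (ℕ; zero; suc; _+_; _*_; _≤_; _<_; z≤n; s≤s)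
  import Data.Nat.Properties as ℕ
  open import Data.Fin using (Fin; toℕ; fromℕ<)
  open import Data.Fin.Properties using (_≟_; toℕ-fromℕ<; toℕ<n; any?)
  open import Data.List using (List; length; allFin)
  open import Data.List.Membership.Propositional using (_∈_)
  open import Data.List.Membership.Propositional.Properties using (∈-allFin)
  open import Data.Product using (Σ; ∃; _×_; _,_; proj₁; proj₂)
  open import Data.Sum using (inj₁; inj₂)
  open import Data.Empty using (⊥; ⊥-elim)
  open import Function using (_∘_)
  open import Relation.Nullary using (¬_; Dec; yes; no)
  open import Relation.Nullary.Decidable using (_×-dec_)
  open import Relation.Binary.PropositionalEquality
  import Data.Nat.Tactic.RingSolver as ℕ-Solver

  open PartialEdgeColouring G K
  open KempeChains G K

  private
    Δ : ℕ
    Δ = maxDegree G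

  Δ≤K : Δ ≤ K
  Δ≤K = ℕ.≮⇒≥ λ K<Δ → ℕ.m+1+n≰m (2 * K + 1) (ℕ.≤-trans (ℕ.≤-reflexive (sym (split K))) (ℕ.≤-trans (ℕ.*-monoʳ-≤ 3 K<Δ) enough))
    where
    split : ∀ K → 3 * suc K ≡ (2 * K + 1) + suc (suc K)
    split = ℕ-Solver.solve-∀

  abstract
    missingAt : ∀ t c x e → Incident G x e → ¬ Coloured t e → ∃ λ α → Missing t c x α
    missingAt t c x e xe ¬ce = missing K (present t c x) (ℕ.<-≤-trans (length-present< t c x e xe ¬ce) (ℕ.≤-trans (degree≤maxDegree G x) Δ≤K))

  commonMissing? : ∀ t c x y → Dec (Σ (Fin K) λ α → Missing t c x α × Missing t c y α)
  commonMissing? t c x y = any? λ α → missing? x α ×-dec missing? y α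
    where
    missing? : ∀ z α → Dec (Missing t c z α)
    missing? z α with α ∈? present t c z
    ... | yes present = no λ absent → absent present
    ... | no absent = yes absent

  module Step (t : ℕ) (t<m : t < m G) (c : Colouring) (proper : ProperUpTo t c) where

    e₀ : Fin (m G)
    e₀ = fromℕ< t<m
    u v : Fin (n G)
    u = end₁ e₀
    v = end₂ e₀

    e₀=t : toℕ e₀ ≡ t
    e₀=t = toℕ-fromℕ< t<m

    e₀-uncoloured : ¬ Coloured t e₀
    e₀-uncoloured = ℕ.<-irrefl e₀=t

    u≢v : u ≢ v
    u≢v = loopless G e₀

    Extension : Set
    Extension = Σ Colouring (ProperUpTo (suc t))

    -- Case: α is missing at u and on the edge f = vw, and β is missing at v and
    -- w: recolour f with β, then α is missing at both ends of e₀.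
    shiftThenColour : ∀ c₀ → ProperUpTo t c₀ → ∀ f w α β → Coloured t f → Joins G f v w → c₀ f ≡ α →
      Missing t c₀ u α → Missing t c₀ v β → Missing t c₀ w β → Extension
    shiftThenColour c₀ proper₀ f w α β cf joins fα miss-uα miss-vβ miss-wβ =
      setColour c′ e₀ α , colourNext c′ e₀ α e₀=t (recolour c₀ f v w β proper₀ joins miss-vβ miss-wβ) miss-uα′ miss-vα′
      where
      c′ : Colouring
      c′ = setColour c₀ f β
      -- no edge at u other than f had colour α, and f now has colour β ≢ α
      miss-uα′ : Missing t c′ u α
      miss-uα′ present = let (h , ch , uh , eq) = present-elim present in byCases h ch uh eq (h ≟ f)
        where
        byCases : ∀ h → Coloured t h → Incident G u h → c′ h ≡ α → Dec (h ≡ f) → ⊥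
        byCases h ch uh eq (yes h=f) = missing-unused miss-uα cf (subst (Incident G u) h=f uh) fα
        byCases h ch uh eq (no h≢f) = missing-unused miss-uα ch uh (trans (sym (setColour-away c₀ f β h h≢f)) eq)
      -- at v, f was the only edge coloured α, and it now has colour β ≢ α
      miss-vα′ : Missing t c′ v α
      miss-vα′ present = let (h , ch , vh , eq) = present-elim present in byCases h ch vh eq (h ≟ f)
        where
        byCases : ∀ h → Coloured t h → Incident G v h → c′ h ≡ α → Dec (h ≡ f) → ⊥
        byCases h ch vh eq (yes h=f) = missing-unused miss-vβ cf (joins-first joins) (trans fα (trans (sym eq) (setColour-at c₀ f β h h=f)))
        byCases h ch vh eq (no h≢f) = proper₀ h f ch cf h≢f (v , vh , joins-first joins) (trans (trans (sym (setColour-away c₀ f β h h≢f)) eq) (sym fα))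

    -- Swap β and γ along the Kempe
    -- chain from u; if it avoids v, γ becomes missing at both ends of e₀, and
    -- otherwise it ends at v, avoids w, and the previous case applies.
    kempeCase : ∀ f w α β γ → Coloured t f → Joins G f v w → c f ≡ α → Missing t c u α →
      Missing t c u β → Missing t c w β → Missing t c v γ → β ≢ γ → Extension
    kempeCase f w α β γ cf joins fα miss-uα miss-uβ miss-wβ miss-vγ β≢γ = byChain (onChain? v)
      where
      open ColourPair β γ β≢γ
      open KempeChain t c proper β γ β≢γ u miss-uβ
      open KempeSwap t c proper β γ β≢γ OnChain onChain? onChain-closed

      α∉pair : ¬ InPair α
      α∉pair (inj₁ α=β) = missing-unused miss-wβ cf (joins-second joins) (trans fα α=β)
      α∉pair (inj₂ α=γ) = missing-unused miss-vγ cf (joins-first joins) (trans fα α=γ)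

      w≢u : w ≢ u
      w≢u w=u = missing-unused miss-uα cf (subst (λ z → Incident G z f) w=u (joins-second joins)) fα

      byChain : Dec (OnChain v) → Extension
      byChain (no v∉chain) =
        setColour swapped e₀ γ , colourNext swapped e₀ γ e₀=t swapped-proper
          (subst (Missing t swapped u) swap-β (missing-inside u β u-onChain (inj₁ refl) miss-uβ))
          (missing-outside v γ v∉chain miss-vγ)
      byChain (yes v∈chain) =
        shiftThenColour swapped swapped-proper f w α β cf joins
          (trans (swapped-unpaired f (α∉pair ∘ subst InPair fα)) fα)
          (missing-unpaired u α α∉pair miss-uα)
          (subst (Missing t swapped v) swap-γ (missing-inside v γ v∈chain (inj₂ refl) miss-vγ))
          (missing-outside w β w∉chain miss-wβ)
        where
        -- both v and w would be the last vertex of the chain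
        w∉chain : ¬ OnChain w
        w∉chain w∈chain = joins-distinct joins (trans
          (onChain-missing v v∈chain (u≢v ∘ sym) (inj₂ miss-vγ))
          (sym (onChain-missing w w∈chain w≢u (inj₁ miss-wβ))))

    -- Case: no two of u, v, w have a common missing colour.  Then every colour
    -- is present at two of them, so 2K ≤ |P u| + |P v| + |P w| ≤ 3Δ - 2 < 2K.
    pairwiseCommon : ∀ w → ¬ Σ (Fin K) (λ α → Missing t c u α × Missing t c v α) →
      ¬ Σ (Fin K) (λ α → Missing t c v α × Missing t c w α) → ¬ Σ (Fin K) (λ α → Missing t c u α × Missing t c w α) → ⊥
    pairwiseCommon w ¬uv ¬vw ¬uw =
      ℕ.1+n≰n (subst (_≤ 2 * K + 1) (cong suc (ℕ.+-comm 1 (2 * K))) (ℕ.≤-trans (s≤s (s≤s counted)) (ℕ.≤-trans total enough)))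
      where
      P : Fin (n G) → List (Fin K)
      P = present t c
      twoOf : ∀ α → TwoOf (α ∈ P u) (α ∈ P v) (α ∈ P w)
      twoOf α with α ∈? P u | α ∈? P v | α ∈? P w
      ... | yes pu | yes pv | _ = inj₁ (pu , pv)
      ... | yes pu | no mv | yes pw = inj₂ (inj₁ (pu , pw))
      ... | no mu | yes pv | yes pw = inj₂ (inj₂ (pv , pw))
      ... | yes _ | no mv | no mw = ⊥-elim (¬vw (α , mv , mw))
      ... | no mu | no mv | _ = ⊥-elim (¬uv (α , mu , mv))
      ... | no mu | yes _ | no mw = ⊥-elim (¬uw (α , mu , mw))
      counted : 2 * K ≤ length (P u) + length (P v) + length (P w)
      counted = count-twoOfThree K (P u) (P v) (P w) twoOf
      fewer : ∀ x → Incident G x e₀ → suc (length (P x)) ≤ Δ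
      fewer x xe₀ = ℕ.≤-trans (length-present< t c x e₀ xe₀ e₀-uncoloured) (degree≤maxDegree G x)
      total : suc (suc (length (P u) + length (P v) + length (P w))) ≤ 3 * Δ
      total = ℕ.≤-trans (ℕ.≤-reflexive (regroup (length (P u)) (length (P v)) (length (P w))))
        (ℕ.≤-trans (ℕ.+-mono-≤ (ℕ.+-mono-≤ (fewer u (inj₁ refl)) (fewer v (inj₂ refl)))
                               (ℕ.≤-trans (length-present t c w) (degree≤maxDegree G w)))
                   (ℕ.≤-reflexive (threeTimes Δ)))
        where
        regroup : ∀ a b d → suc (suc (a + b + d)) ≡ suc a + suc b + d
        regroup = ℕ-Solver.solve-∀
        threeTimes : ∀ D → D + D + D ≡ 3 * D
        threeTimes = ℕ-Solver.solve-∀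

    extension : Extension
    extension with commonMissing? t c u v
    ... | yes (α , miss-uα , miss-vα) = setColour c e₀ α , colourNext c e₀ α e₀=t proper miss-uα miss-vα
    ... | no ¬uv = viaNeighbour (commonMissing? t c v w) (commonMissing? t c u w)
      where
      -- α is missing at u, hence present at v, on an edge f = vw
      α : Fin K
      α = proj₁ (missingAt t c u e₀ (inj₁ refl) e₀-uncoloured)
      miss-uα : Missing t c u α
      miss-uα = proj₂ (missingAt t c u e₀ (inj₁ refl) e₀-uncoloured)
      α-at-v : α ∈ present t c v
      α-at-v with α ∈? present t c v
      ... | yes p = p
      ... | no miss-vα = ⊥-elim (¬uv (α , miss-uα , miss-vα))
      f : Fin (m G)
      f = proj₁ (present-elim α-at-v)
      cf : Coloured t f
      cf = proj₁ (proj₂ (present-elim α-at-v))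
      vf : Incident G v f
      vf = proj₁ (proj₂ (proj₂ (present-elim α-at-v)))
      fα : c f ≡ α
      fα = proj₂ (proj₂ (proj₂ (present-elim α-at-v)))
      w : Fin (n G)
      w = proj₁ (otherEnd vf)
      joins : Joins G f v w
      joins = proj₂ (otherEnd vf)

      viaNeighbour : Dec (Σ (Fin K) λ β → Missing t c v β × Missing t c w β) →
                     Dec (Σ (Fin K) λ β → Missing t c u β × Missing t c w β) → Extension
      viaNeighbour (yes (β , miss-vβ , miss-wβ)) _ = shiftThenColour c proper f w α β cf joins fα miss-uα miss-vβ miss-wβ
      viaNeighbour (no ¬vw) (yes (β , miss-uβ , miss-wβ)) =
        kempeCase f w α β γ cf joins fα miss-uα miss-uβ miss-wβ miss-vγ (λ β=γ → ¬uv (β , miss-uβ , subst (Missing t c v) (sym β=γ) miss-vγ))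
        where
        γ : Fin K
        γ = proj₁ (missingAt t c v e₀ (inj₂ refl) e₀-uncoloured)
        miss-vγ : Missing t c v γ
        miss-vγ = proj₂ (missingAt t c v e₀ (inj₂ refl) e₀-uncoloured)
      viaNeighbour (no ¬vw) (no ¬uw) = ⊥-elim (pairwiseCommon w ¬uv ¬vw ¬uw)

  colourFirst : ∀ t → t ≤ m G → Σ Colouring (ProperUpTo t)
  colourFirst zero _ = (λ e → fromℕ< (ℕ.≤-trans (degree-positive e) (ℕ.≤-trans (degree≤maxDegree G (end₁ e)) Δ≤K))) , λ e f ()
    where
    -- an edge has an end of positive degree, so K > 0 when there are edges
    degree-positive : ∀ e → 1 ≤ degree G (end₁ e)
    degree-positive e = ℕ.≤-trans (s≤s z≤n)
      (length-filter-strict {Q = λ _ → ⊥} (incident? (end₁ e)) (λ _ → no λ ()) (λ _ ()) (allFin (m G)) (∈-allFin e) (inj₁ refl) (λ ()))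
  colourFirst (suc t) t<m = let (c , proper) = colourFirst t (ℕ.≤-trans (ℕ.n≤1+n t) t<m) in Step.extension t t<m c proper

  shannon : EdgeColourable G K
  shannon = let (c , proper) = colourFirst (m G) ℕ.≤-refl in c , λ e f e≢f shared → proper e f (toℕ<n e) (toℕ<n f) e≢f shared

module LinkGraphBounds where

  open LinkColourings using (linkColourable-mono; vertexColouring⇒0-link; edgeColouring⇒1-link; compressTwoSteps; linkColourable-skipTwo)
  open TwoThirdsCompression using (twoThirdsFloor; three*twoThirdsFloor≤; twoThirdsCompression)
  open ShrinkBound using (shrink; shrinkIter)
  open GreedyColouring using (greedyColouring)
  open import Data.Nat using (ℕ; zero; suc; _+_; _*_; _≤_; z≤n; s≤s; ⌊_/2⌋)
  import Data.Nat.Properties as ℕ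
  open import Data.Product using (Σ-syntax; _×_; _,_; proj₁; proj₂)
  open import Data.Sum using (_⊎_; inj₁; inj₂)
  open import Data.Empty using (⊥-elim)
  open import Relation.Binary.PropositionalEquality
  import Data.Nat.Tactic.RingSolver as ℕ-Solver

  parity : ∀ ℓ → Σ[ j ∈ ℕ ] (ℓ ≡ 2 * j ⊎ ℓ ≡ suc (2 * j))
  parity zero = 0 , inj₁ refl
  parity (suc ℓ) with parity ℓ
  ... | j , inj₁ even = j , inj₂ (cong suc even)
  ... | j , inj₂ odd = suc j , inj₁ (trans (cong suc odd) (sym (ℕ.*-suc 2 j)))

  halves : ∀ n → 2 * ⌊ n /2⌋ ≤ n × n ≤ 2 * ⌊ n /2⌋ + 1
  halves zero = z≤n , z≤n
  halves (suc zero) = z≤n , s≤s z≤n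
  halves (suc (suc n)) = let (lower , upper) = halves n in
    subst (_≤ suc (suc n)) (sym (ℕ.*-suc 2 ⌊ n /2⌋)) (s≤s (s≤s lower)) ,
    subst (suc (suc n) ≤_) (sym (cong (_+ 1) (ℕ.*-suc 2 ⌊ n /2⌋))) (s≤s (s≤s upper))

  module _ (G : Graph) where

    -- Two more steps cost one application of shrink: use the cheaper of keeping
    -- the middle colour and compressing to ⌊2k/3⌋ + 1 colours.
    shrinkTwoSteps : ∀ {ℓ k} → LinkColourable G ℓ k → LinkColourable G (suc (suc ℓ)) (shrink k)
    shrinkTwoSteps {ℓ} {k} L with ℕ.⊓-sel k (suc (twoThirdsFloor k))
    ... | inj₁ min=k = subst (LinkColourable G (suc (suc ℓ))) (sym min=k) (linkColourable-skipTwo G L)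
    ... | inj₂ min=compressed = subst (LinkColourable G (suc (suc ℓ))) (sym min=compressed)
                                  (compressTwoSteps G (twoThirdsCompression k) L)

    shrinkRepeatedly : ∀ {ℓ k} → LinkColourable G ℓ k → ∀ j → LinkColourable G (2 * j + ℓ) (shrinkIter k j)
    shrinkRepeatedly L zero = L
    shrinkRepeatedly {ℓ} {k} L (suc j) = subst (λ l → LinkColourable G (l + ℓ) (shrinkIter k (suc j))) (sym (ℕ.*-suc 2 j))
      (shrinkTwoSteps (shrinkRepeatedly L j))

    skipRepeatedly : ∀ {ℓ k} → LinkColourable G ℓ k → ∀ j → LinkColourable G (2 * j + ℓ) k
    skipRepeatedly L zero = L
    skipRepeatedly {ℓ} {k} L (suc j) = subst (λ l → LinkColourable G (l + ℓ) k) (sym (ℕ.*-suc 2 j))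
      (linkColourable-skipTwo G (skipRepeatedly L j))

    evenLinks : ∀ {χ} → Colourable G χ → ∀ j → LinkColourable G (2 * j) (shrinkIter χ j)
    evenLinks {χ} C j = subst (λ l → LinkColourable G l (shrinkIter χ j)) (ℕ.+-identityʳ (2 * j))
      (shrinkRepeatedly (vertexColouring⇒0-link G C) j)

    oddLinks : ∀ {χ'} → EdgeColourable G χ' → ∀ j → LinkColourable G (suc (2 * j)) (shrinkIter χ' j)
    oddLinks {χ'} C j = subst (λ l → LinkColourable G l (shrinkIter χ' j)) (ℕ.+-comm (2 * j) 1)
      (shrinkRepeatedly (edgeColouring⇒1-link G C) j)

    private
      Δ : ℕ
      Δ = maxDegree G

    -- L_3(G) is (Δ+1)-colourable: edge-colour G with ⌊3Δ/2⌋ colours (Shannon)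
    -- and compress to ⌊2⌊3Δ/2⌋/3⌋ + 1 ≤ Δ + 1 colours.
    threeLinks : LinkColourable G 3 (suc Δ)
    threeLinks = linkColourable-mono G (s≤s fewEnough)
      (compressTwoSteps G (twoThirdsCompression K) (edgeColouring⇒1-link G (Shannon.shannon G K shannonBound)))
      where
      K : ℕ
      K = ⌊ 3 * Δ /2⌋
      shannonBound : 3 * Δ ≤ 2 * K + 1
      shannonBound = proj₂ (halves (3 * Δ))
      fewEnough : twoThirdsFloor K ≤ Δ
      fewEnough = ℕ.*-cancelˡ-≤ 3 (ℕ.≤-trans (three*twoThirdsFloor≤ K) (proj₁ (halves (3 * Δ))))

    maxDegreeBound : ∀ ℓ → ℓ ≢ 1 → LinkColourable G ℓ (suc Δ)
    maxDegreeBound ℓ ℓ≢1 with parity ℓ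
    ... | j , inj₁ refl = subst (λ l → LinkColourable G l (suc Δ)) (ℕ.+-identityʳ (2 * j))
                            (skipRepeatedly (vertexColouring⇒0-link G (greedyColouring G)) j)
    ... | zero , inj₂ refl = ⊥-elim (ℓ≢1 refl)
    ... | suc j , inj₂ refl = subst (λ l → LinkColourable G l (suc Δ)) (odd j) (skipRepeatedly threeLinks j)
      where
      odd : ∀ j → 2 * j + 3 ≡ suc (2 * suc j)
      odd = ℕ-Solver.solve-∀

open LinkColourings using (linkColourable-mono; linkColourable-skipTwo)
open ShrinkBound using (boundAsNat)
open LinkGraphBounds using (evenLinks; oddLinks; maxDegreeBound)
open import Data.Nat using (s≤s)
open import Data.Product using (_,_)
open import Relation.Binary.PropositionalEquality using (refl)

mainTheorem7 : (G : Graph) (χ χ' : ℕ) → IsChromaticNumber G χ → IsEdgeChromaticNumber G χ' →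
    (ℓ : ℕ) →
    ((j : ℕ) → ℓ ≡ 2 * j → Σ[ k ∈ ℕ ] ((+ k ≡ bound χ j) × LinkColourable G ℓ k))
    × ((j : ℕ) → ℓ ≡ suc (2 * j) → Σ[ k ∈ ℕ ] ((+ k ≡ bound χ' j) × LinkColourable G ℓ k))
    × (ℓ ≢ 1 → LinkColourable G ℓ (suc (maxDegree G)))
    × (2 ≤ ℓ → (k : ℕ) → LinkColourable G (ℓ ∸ 2) k → LinkColourable G ℓ k)
mainTheorem7 G χ χ' (colourable , _) (edgeColourable , _) ℓ = even , odd , maxDegreeBound G ℓ , skipTwo
  where
  even : (j : ℕ) → ℓ ≡ 2 * j → Σ[ k ∈ ℕ ] ((+ k ≡ bound χ j) × LinkColourable G ℓ k)
  even j refl = let (k , k=bound , enough) = boundAsNat χ j in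
    k , k=bound , linkColourable-mono G enough (evenLinks G colourable j)
  odd : (j : ℕ) → ℓ ≡ suc (2 * j) → Σ[ k ∈ ℕ ] ((+ k ≡ bound χ' j) × LinkColourable G ℓ k)
  odd j refl = let (k , k=bound , enough) = boundAsNat χ' j in
    k , k=bound , linkColourable-mono G enough (oddLinks G edgeColourable j)
  skipTwo : 2 ≤ ℓ → (k : ℕ) → LinkColourable G (ℓ ∸ 2) k → LinkColourable G ℓ k
  skipTwo (s≤s (s≤s _)) k = linkColourable-skipTwo G
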